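{- Let $G$ be a bubble with contact vertex $z$ and partition $(I,R)$, and let $n(G)$ denote the number of vertices of $G$. Then $$\alpha(G)=\alpha(G-z)=\mu(G)=\mu(G-z)=\frac{n(G)-1}{2}.$$ Furthermore, if $G$ is not $2$-connected, then some proper induced subgraph $G'$ of $G$ is also a bubble, with some contact vertex and some partition $(I',R')$ such that $I'\subseteq I$ and $R'\subseteq R$.
   Context: All graphs are finite, simple and undirected. $\alpha(G)$ is the independence number and $\mu(G)$ the matching number of $G$. A graph $G$ is a bubble with contact vertex $z$ and partition $(I,R)$ if $z\in V(G)$ and $V(G)$ is partitioned into two sets $I$ and $R$ such that: every vertex in $V(G)\setminus\{z\}$ has degree $3$ and $z$ has degree $2$; $I$ is an independent set; and $z\in R$ and the induced subgraph $G[R]$ contains exactly one edge. -}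

module Defs where

open import Data.Nat using (ℕ; suc; _≤_; _+_; _*_)
open import Data.Bool using (Bool; true; false)
open import Data.Fin using (Fin)
open import Data.Fin.Subset using (Subset; _∈_; _∉_; _∩_; _─_; ⁅_⁆; ∣_∣; ⊤; _⊆_)
open import Data.Vec using (tabulate)
open import Data.Product using (Σ; _×_; _,_; ∃)
open import Data.Sum using (_⊎_)
open import Relation.Binary.PropositionalEquality using (_≡_; _≢_)
open import Relation.Nullary using (¬_)

record Graph (n : ℕ) : Set where
  field
    adj    : Fin n → Fin n → Bool
    sym    : ∀ u v → adj u v ≡ adj v u
    irrefl : ∀ v → adj v v ≡ false
open Graph public

module _ {n : ℕ} (G : Graph n) where

  -- Throughout, a vertex set S : Subset n stands for the induced subgraph G[S].

  N : Fin n → Subset n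
  N v = tabulate (adj G v)

  degIn : Subset n → Fin n → ℕ
  degIn S v = ∣ S ∩ N v ∣

  IndepSetOfSize : Subset n → ℕ → Set
  IndepSetOfSize S k =
    Σ (Fin k → Fin n) λ f →
      (∀ i → f i ∈ S) ×
      (∀ i j → i ≢ j → f i ≢ f j) ×
      (∀ i j → adj G (f i) (f j) ≡ false)

  IsIndepNumber : Subset n → ℕ → Set
  IsIndepNumber S a = IndepSetOfSize S a × (∀ k → IndepSetOfSize S k → k ≤ a)

  MatchingOfSize : Subset n → ℕ → Set
  MatchingOfSize S k =
    Σ (Fin k → Fin n) λ f → Σ (Fin k → Fin n) λ g →
      (∀ i → f i ∈ S) × (∀ i → g i ∈ S) ×
      (∀ i → adj G (f i) (g i) ≡ true) ×
      (∀ i j → i ≢ j → f i ≢ f j) ×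
      (∀ i j → i ≢ j → g i ≢ g j) ×
      (∀ i j → f i ≢ g j)

  IsMatchingNumber : Subset n → ℕ → Set
  IsMatchingNumber S m = MatchingOfSize S m × (∀ k → MatchingOfSize S k → k ≤ m)

  IsBubble : Subset n → Fin n → Subset n → Subset n → Set
  IsBubble S z I R =
    (∀ v → v ∈ S → (v ∈ I ⊎ v ∈ R)) ×
    I ⊆ S × R ⊆ S ×
    (∀ v → v ∈ I → v ∉ R) ×
    z ∈ R ×
    degIn S z ≡ 2 ×
    (∀ v → v ∈ S → v ≢ z → degIn S v ≡ 3) ×
    (∀ u v → u ∈ I → v ∈ I → adj G u v ≡ false) ×
    (Σ (Fin n) λ a → Σ (Fin n) λ b →
       a ∈ R × b ∈ R × adj G a b ≡ true ×
       (∀ c d → c ∈ R → d ∈ R → adj G c d ≡ true →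
          (c ≡ a × d ≡ b) ⊎ (c ≡ b × d ≡ a)))

  data Reach (S : Subset n) (u : Fin n) : Fin n → Set where
    here : u ∈ S → Reach S u u
    step : ∀ {v w} → Reach S u v → w ∈ S → adj G v w ≡ true → Reach S u w

  Connected : Subset n → Set
  Connected S = ∀ u v → u ∈ S → v ∈ S → Reach S u v

  TwoConnected : Set
  TwoConnected = 3 ≤ n × Connected ⊤ × (∀ v → Connected (⊤ ─ ⁅ v ⁆))

module Submission where

-- Double counting the edges at I and at R: I is independent and avoids z, so its 3|I| edge ends all lie in R,
-- whose 3|R| − 1 edge ends consist of these plus both ends of the single R-edge. Hence |R| = |I| + 1 and
-- n = 2|I| + 1. I is an independent set avoiding z, and Hall's theorem matches I into R − z, because X ⊆ I
-- sends 3|X| edges into R, of which z absorbs at most 2 and every other vertex at most 3. Conversely an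
-- independent set of size k sends its edges to the remaining n − k vertices, and a matching of size k
-- covers 2k vertices, so neither exceeds (n − 1)/2.
--
-- The same count, applied to an induced subgraph H in which one vertex w has degree 2 and all others degree 3,
-- shows that w ∈ R and that H contains the R-edge, so H is a bubble with partition (I ∩ H, R ∩ H). If G is
-- disconnected, the side of a separation containing z is such an H. If v is a cut vertex, its at most three
-- edges are shared by the two sides: a side avoiding z that meets v once is such an H (with the neighbour of v
-- as contact vertex), and otherwise a side meeting v twice, together with v, is one (with contact vertex v).

open import Data.Bool using (Bool; true; false; _∧_; _∨_; not)
import Data.Bool as Bool
open import Data.Bool.Properties using (∧-identityʳ; ∧-zeroʳ; ∧-comm; ∧-assoc; ∨-identityʳ; ∨-zeroʳ; ¬-not; not-¬)
open import Data.Empty using (⊥-elim)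
open import Data.Fin using (Fin; zero; suc; _≟_)
import Data.Fin.Properties as Fin
open import Data.Fin.Subset.Properties using (anySubset?)
open import Data.Fin.Subset using (Subset; _∈_; _∉_; _∩_; _─_; ⁅_⁆; ∣_∣; ⊤; _⊆_) renaming (⊥ to ∅)
open import Data.Nat hiding (_≟_)
import Data.Nat as ℕ
open import Data.Nat.Properties hiding (_≟_)
open import Data.Product using (Σ; ∃; _×_; _,_; proj₁; proj₂)
open import Data.Sum using (_⊎_; inj₁; inj₂)
import Data.Sum
open import Data.Vec using ([]; _∷_; lookup; tabulate)
open import Data.Vec.Properties using (lookup∘tabulate; lookup-zipWith; lookup-replicate; []=⇒lookup; lookup⇒[]=)
open import Function using (_∘_)
open import Relation.Binary.PropositionalEquality
open import Relation.Nullary using (¬_; Dec; yes; no; does)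
open import Relation.Nullary.Decidable using (_×-dec_; _→-dec_)
open import Algebra.Properties.Semiring.Sum +-*-semiring
  using (sum; sum-cong-≗; ∑-distrib-+; ∑-comm; *-distribˡ-sum; *-distribʳ-sum)

open import Defs hiding (sym)

𝟙 : Bool → ℕ
𝟙 true = 1
𝟙 false = 0

𝟙-∧ : ∀ a b → 𝟙 (a ∧ b) ≡ 𝟙 a * 𝟙 b
𝟙-∧ true b = sym (+-identityʳ (𝟙 b))
𝟙-∧ false b = refl

𝟙≤1 : ∀ a → 𝟙 a ≤ 1
𝟙≤1 true = ≤-refl
𝟙≤1 false = z≤n

𝟙-pos : ∀ {a} → 0 < 𝟙 a → a ≡ true
𝟙-pos {true} _ = refl

sum-mono-≤ : ∀ {n} {f g : Fin n → ℕ} → (∀ i → f i ≤ g i) → sum f ≤ sum g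
sum-mono-≤ {zero} _ = z≤n
sum-mono-≤ {suc n} f≤g = +-mono-≤ (f≤g zero) (sum-mono-≤ (f≤g ∘ suc))

sum-mono-< : ∀ {n} {f g : Fin n → ℕ} → (∀ i → f i ≤ g i) → ∀ j → f j < g j → sum f < sum g
sum-mono-< {suc n} f≤g zero fj<gj = +-mono-<-≤ fj<gj (sum-mono-≤ (f≤g ∘ suc))
sum-mono-< {suc n} f≤g (suc j) fj<gj = +-mono-≤-< (f≤g zero) (sum-mono-< (f≤g ∘ suc) j fj<gj)

sum-zero : ∀ {n} {f : Fin n → ℕ} → (∀ i → f i ≡ 0) → sum f ≡ 0
sum-zero {zero} _ = refl
sum-zero {suc n} f≡0 = cong₂ _+_ (f≡0 zero) (sum-zero (f≡0 ∘ suc))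

sum-const-1 : ∀ n → sum {n} (λ _ → 1) ≡ n
sum-const-1 zero = refl
sum-const-1 (suc n) = cong suc (sum-const-1 n)

sum-≤-length : ∀ {n} (f : Fin n → ℕ) → (∀ i → f i ≤ 1) → sum f ≤ n
sum-≤-length {n} f f≤1 = ≤-trans (sum-mono-≤ f≤1) (≤-reflexive (sum-const-1 n))

term≤sum : ∀ {n} (f : Fin n → ℕ) j → f j ≤ sum f
term≤sum {suc n} f zero = m≤m+n (f zero) _
term≤sum {suc n} f (suc j) = ≤-trans (term≤sum (f ∘ suc) j) (m≤n+m _ (f zero))

sum-pos : ∀ {n} (f : Fin n → ℕ) → 0 < sum f → ∃ λ i → 0 < f i
sum-pos {suc n} f pos with f zero in eq
... | suc _ = zero , subst (0 <_) (sym eq) z<s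
... | zero with sum-pos (f ∘ suc) pos
... | i , fi>0 = suc i , fi>0

sum-*ˡ : ∀ {n} c (f : Fin n → ℕ) → sum (λ i → c * f i) ≡ c * sum f
sum-*ˡ c f = sym (*-distribˡ-sum c f)

_==_ : ∀ {n} → Fin n → Fin n → Bool
x == y = does (x ≟ y)

δ : ∀ {n} → Fin n → Fin n → ℕ
δ x y = 𝟙 (x == y)

==-refl : ∀ {n} (x : Fin n) → (x == x) ≡ true
==-refl x with x ≟ x
... | yes _ = refl
... | no x≢x = ⊥-elim (x≢x refl)

==-≢ : ∀ {n} {x y : Fin n} → x ≢ y → (x == y) ≡ false
==-≢ {x = x} {y} x≢y with x ≟ y
... | yes x≡y = ⊥-elim (x≢y x≡y)
... | no _ = refl

==-sound : ∀ {n} {x y : Fin n} → (x == y) ≡ true → x ≡ y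
==-sound {x = x} {y} _ with x ≟ y
... | yes x≡y = x≡y

==-subst : ∀ {n} (P : Fin n → Bool) {u x} → (u == x) ≡ true → P x ≡ true → P u ≡ true
==-subst P {u} u≡x Px = subst (λ u → P u ≡ true) (sym (==-sound {x = u} u≡x)) Px

δ-refl : ∀ {n} (x : Fin n) → δ x x ≡ 1
δ-refl x = cong 𝟙 (==-refl x)

δ-≢ : ∀ {n} {x y : Fin n} → x ≢ y → δ x y ≡ 0
δ-≢ x≢y = cong 𝟙 (==-≢ x≢y)

sum-δ : ∀ {n} (p : Fin n) (f : Fin n → ℕ) → sum (λ i → δ i p * f i) ≡ f p
sum-δ {suc n} zero f = begin
  1 * f zero + sum {n} (λ _ → 0) ≡⟨ cong₂ _+_ (*-identityˡ (f zero)) (sum-zero {n} (λ _ → refl)) ⟩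
  f zero + 0                     ≡⟨ +-identityʳ (f zero) ⟩
  f zero                         ∎
  where open ≡-Reasoning
sum-δ {suc n} (suc p) f = sum-δ p (f ∘ suc)

sum-δ-1 : ∀ {n} (p : Fin n) → sum (λ i → δ i p) ≡ 1
sum-δ-1 p = trans (sum-cong-≗ (λ i → sym (*-identityʳ (δ i p)))) (sum-δ p (λ _ → 1))

∧-true⁻ : ∀ {a b} → a ∧ b ≡ true → a ≡ true × b ≡ true
∧-true⁻ {true} {true} _ = refl , refl

∧-true⁺ : ∀ {a b} → a ≡ true → b ≡ true → a ∧ b ≡ true
∧-true⁺ refl refl = refl

∨-true⁻ : ∀ {a b} → a ∨ b ≡ true → a ≡ true ⊎ b ≡ true
∨-true⁻ {true} _ = inj₁ refl
∨-true⁻ {false} b≡true = inj₂ b≡true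

∨-introˡ : ∀ {a b} → a ≡ true → a ∨ b ≡ true
∨-introˡ refl = refl

∨-introʳ : ∀ {a b} → b ≡ true → a ∨ b ≡ true
∨-introʳ {a} refl = ∨-zeroʳ a

not-true⁻ : ∀ {a} → not a ≡ true → a ≡ false
not-true⁻ {false} _ = refl

any : ∀ {n} → (Fin n → Bool) → Bool
any {zero} p = false
any {suc n} p = p zero ∨ any (p ∘ suc)

any-sound : ∀ {n} (p : Fin n → Bool) → any p ≡ true → ∃ λ i → p i ≡ true
any-sound {suc n} p any≡true with p zero in p0
... | true = zero , p0
... | false with any-sound (p ∘ suc) any≡true
... | i , pi = suc i , pi

any-complete : ∀ {n} (p : Fin n → Bool) i → p i ≡ true → any p ≡ true
any-complete {suc n} p zero p0 rewrite p0 = refl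
any-complete {suc n} p (suc i) pi with p zero
... | true = refl
... | false = any-complete (p ∘ suc) i pi

any-cong : ∀ {n} {p q : Fin n → Bool} → (∀ i → p i ≡ q i) → any p ≡ any q
any-cong {zero} _ = refl
any-cong {suc n} p≗q = cong₂ _∨_ (p≗q zero) (any-cong (p≗q ∘ suc))

card : ∀ {n} → (Fin n → Bool) → ℕ
card P = sum (𝟙 ∘ P)

_⊆ᵇ_ : ∀ {n} → (Fin n → Bool) → (Fin n → Bool) → Set
X ⊆ᵇ Y = ∀ x → X x ≡ true → Y x ≡ true

_∖ᵇ_ : ∀ {n} → (Fin n → Bool) → (Fin n → Bool) → Fin n → Bool
(P ∖ᵇ Q) x = P x ∧ not (Q x)

_∩ᵇ_ : ∀ {n} → (Fin n → Bool) → (Fin n → Bool) → Fin n → Bool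
(P ∩ᵇ Q) x = P x ∧ Q x

_∪ᵇ_ : ∀ {n} → (Fin n → Bool) → (Fin n → Bool) → Fin n → Bool
(P ∪ᵇ Q) x = P x ∨ Q x

card-cong : ∀ {n} {P Q : Fin n → Bool} → (∀ x → P x ≡ Q x) → card P ≡ card Q
card-cong P≗Q = sum-cong-≗ (cong 𝟙 ∘ P≗Q)

𝟙-mono : ∀ {a b} → (a ≡ true → b ≡ true) → 𝟙 a ≤ 𝟙 b
𝟙-mono {false} _ = z≤n
𝟙-mono {true} a⇒b rewrite a⇒b refl = ≤-refl

card-mono : ∀ {n} {P Q : Fin n → Bool} → P ⊆ᵇ Q → card P ≤ card Q
card-mono P⊆Q = sum-mono-≤ (λ x → 𝟙-mono (P⊆Q x))

card-mono-< : ∀ {n} {P Q : Fin n → Bool} → P ⊆ᵇ Q → ∀ x → P x ≡ false → Q x ≡ true → card P < card Q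
card-mono-< P⊆Q x Px Qx =
  sum-mono-< (λ y → 𝟙-mono (P⊆Q y)) x (subst₂ (λ a b → 𝟙 a < 𝟙 b) (sym Px) (sym Qx) z<s)

card-pos : ∀ {n} {P : Fin n → Bool} x → P x ≡ true → 1 ≤ card P
card-pos {P = P} x Px = subst (λ b → 𝟙 b ≤ card P) Px (term≤sum (𝟙 ∘ P) x)

card-== : ∀ {n} (p : Fin n) → card (_== p) ≡ 1
card-== = sum-δ-1

𝟙-∨ : ∀ a b → 𝟙 (a ∨ b) ≤ 𝟙 a + 𝟙 b
𝟙-∨ true b = s≤s z≤n
𝟙-∨ false b = ≤-refl

card-∪-≤ : ∀ {n} (P Q : Fin n → Bool) → card (P ∪ᵇ Q) ≤ card P + card Q
card-∪-≤ P Q =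
  ≤-trans (sum-mono-≤ (λ x → 𝟙-∨ (P x) (Q x))) (≤-reflexive (∑-distrib-+ (𝟙 ∘ P) (𝟙 ∘ Q)))

card-∪-disjoint : ∀ {n} {P Q : Fin n → Bool} → (∀ x → P x ≡ true → Q x ≡ false) →
  card (P ∪ᵇ Q) ≡ card P + card Q
card-∪-disjoint {P = P} {Q} disjoint = trans (sum-cong-≗ split) (∑-distrib-+ (𝟙 ∘ P) (𝟙 ∘ Q))
  where
  split : ∀ x → 𝟙 (P x ∨ Q x) ≡ 𝟙 (P x) + 𝟙 (Q x)
  split x with P x in Px
  ... | true rewrite disjoint x Px = refl
  ... | false = refl

𝟙+𝟙-not : ∀ a → 𝟙 a + 𝟙 (not a) ≡ 1
𝟙+𝟙-not true = refl
𝟙+𝟙-not false = refl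

card-complement : ∀ {n} (P : Fin n → Bool) → card P + card (not ∘ P) ≡ n
card-complement {n} P =
  trans (sym (∑-distrib-+ (𝟙 ∘ P) (𝟙 ∘ not ∘ P))) (trans (sum-cong-≗ (𝟙+𝟙-not ∘ P)) (sum-const-1 n))

card-pos⁻ : ∀ {n} {P : Fin n → Bool} → 0 < card P → ∃ λ x → P x ≡ true
card-pos⁻ {P = P} pos with sum-pos (𝟙 ∘ P) pos
... | x , Px>0 = x , 𝟙-pos Px>0

∖-⊆ : ∀ {n} {P Q : Fin n → Bool} → (P ∖ᵇ Q) ⊆ᵇ P
∖-⊆ {P = P} x P∖Qx = proj₁ (∧-true⁻ {P x} P∖Qx)

∖-intro : ∀ {n} {P Q : Fin n → Bool} {x} → P x ≡ true → Q x ≢ true → (P ∖ᵇ Q) x ≡ true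
∖-intro Px Qx≢true = ∧-true⁺ Px (cong not (¬-not Qx≢true))

∖-removes : ∀ {n} {P Q : Fin n → Bool} {x} → Q x ≡ true → (P ∖ᵇ Q) x ≡ false
∖-removes {P = P} {x = x} Qx = trans (cong (λ b → P x ∧ not b) Qx) (∧-zeroʳ (P x))

card-≥2 : ∀ {n} {P : Fin n → Bool} {x y} → P x ≡ true → P y ≡ true → x ≢ y → 2 ≤ card P
card-≥2 {P = P} {x} {y} Px Py x≢y = begin
  2                                 ≡⟨ cong₂ _+_ (card-== x) (card-== y) ⟨
  card (_== x) + card (_== y)       ≡⟨ card-∪-disjoint {P = _== x} {Q = _== y} x-apart-y ⟨
  card ((_== x) ∪ᵇ (_== y))         ≤⟨ card-mono x∪y⊆P ⟩
  card P                            ∎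
  where
  open ≤-Reasoning
  x∪y⊆P : ((_== x) ∪ᵇ (_== y)) ⊆ᵇ P
  x∪y⊆P u u≡x∨u≡y with ∨-true⁻ {u == x} u≡x∨u≡y
  ... | inj₁ u≡x = ==-subst P u≡x Px
  ... | inj₂ u≡y = ==-subst P u≡y Py
  x-apart-y : ∀ u → (u == x) ≡ true → (u == y) ≡ false
  x-apart-y u u≡x = ==-≢ (λ u≡y → x≢y (trans (sym (==-sound {x = u} u≡x)) u≡y))

card-empty : ∀ {n} {P : Fin n → Bool} → (∀ x → P x ≢ true) → card P ≡ 0
card-empty {P = P} P-empty = sum-zero absent
  where
  absent : ∀ x → 𝟙 (P x) ≡ 0
  absent x with P x in Px
  ... | true = ⊥-elim (P-empty x Px)
  ... | false = refl

∈-lookup : ∀ {n} {v : Fin n} {S : Subset n} → v ∈ S → lookup S v ≡ true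
∈-lookup = []=⇒lookup

lookup-∈ : ∀ {n} {v : Fin n} {S : Subset n} → lookup S v ≡ true → v ∈ S
lookup-∈ {v = v} {S} = lookup⇒[]= v S

∉-lookup : ∀ {n} {v : Fin n} {S : Subset n} → v ∉ S → lookup S v ≡ false
∉-lookup {v = v} {S} v∉S with lookup S v in eq
... | true = ⊥-elim (v∉S (lookup-∈ eq))
... | false = refl

lookup-⊤ : ∀ {n} (v : Fin n) → lookup ⊤ v ≡ true
lookup-⊤ v = lookup-replicate v true

lookup-⊤─⁅⁆ : ∀ {n} (z v : Fin n) → lookup (⊤ ─ ⁅ z ⁆) v ≡ not (v == z)
lookup-⊤─⁅⁆ {suc n} zero zero = refl
lookup-⊤─⁅⁆ {suc n} zero (suc v) = lookup-⊤─∅ v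
  where
  lookup-⊤─∅ : ∀ {m} (v : Fin m) → lookup (⊤ ─ ∅) v ≡ true
  lookup-⊤─∅ zero = refl
  lookup-⊤─∅ (suc v) = lookup-⊤─∅ v
lookup-⊤─⁅⁆ {suc n} (suc z) zero = refl
lookup-⊤─⁅⁆ {suc n} (suc z) (suc v) = lookup-⊤─⁅⁆ z v

∈-⊤─⁅⁆ : ∀ {n} {z v : Fin n} → v ≢ z → v ∈ ⊤ ─ ⁅ z ⁆
∈-⊤─⁅⁆ {z = z} {v} v≢z = lookup-∈ (trans (lookup-⊤─⁅⁆ z v) (cong not (==-≢ v≢z)))

∣∣≡card : ∀ {n} (S : Subset n) → ∣ S ∣ ≡ card (lookup S)
∣∣≡card [] = refl
∣∣≡card (true ∷ S) = cong suc (∣∣≡card S)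
∣∣≡card (false ∷ S) = ∣∣≡card S

Distinct : ∀ {k n} → (Fin k → Fin n) → Set
Distinct f = ∀ i j → i ≢ j → f i ≢ f j

image : ∀ {k n} → (Fin k → Fin n) → Fin n → Bool
image f v = any (λ i → v == f i)

image-elim : ∀ {k n} (f : Fin k → Fin n) v → image f v ≡ true → ∃ λ i → f i ≡ v
image-elim f v v∈f with any-sound (λ i → v == f i) v∈f
... | i , v≡fi = i , sym (==-sound {x = v} v≡fi)

card-image : ∀ {k n} (f : Fin k → Fin n) → Distinct f → card (image f) ≡ k
card-image {zero} {n} f _ = sum-zero {n} (λ _ → refl)
card-image {suc k} f distinct =
  trans (card-∪-disjoint {P = _== f zero} {Q = image (f ∘ suc)} apart)
        (cong₂ _+_ (card-== (f zero)) (card-image (f ∘ suc) distinct-suc))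
  where
  distinct-suc : Distinct (f ∘ suc)
  distinct-suc i j i≢j = distinct (suc i) (suc j) (i≢j ∘ Fin.suc-injective)
  apart : ∀ v → (v == f zero) ≡ true → image (f ∘ suc) v ≡ false
  apart v v≡f0 with image (f ∘ suc) v Bool.≟ true
  ... | no v∉ = ¬-not v∉
  ... | yes v∈ with image-elim (f ∘ suc) v v∈
  ... | i , fi≡v = ⊥-elim (distinct zero (suc i) (λ ()) (trans (sym (==-sound {x = v} v≡f0)) (sym fi≡v)))

enumerate : ∀ {n} (P : Fin n → Bool) →
  Σ (Fin (card P) → Fin n) λ f → Distinct f × (∀ i → P (f i) ≡ true)
enumerate {zero} P = (λ ()) , (λ ()) , (λ ())
enumerate {suc n} P with P zero in P0 | enumerate (P ∘ suc)
... | false | f , distinct , Pf = suc ∘ f , (λ i j i≢j → distinct i j i≢j ∘ Fin.suc-injective) , Pf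
... | true | f , distinct , Pf = g , distinct-g , Pg
  where
  g : Fin (suc (card (P ∘ suc))) → Fin (suc n)
  g zero = zero
  g (suc i) = suc (f i)
  distinct-g : Distinct g
  distinct-g zero zero 0≢0 _ = 0≢0 refl
  distinct-g zero (suc j) _ ()
  distinct-g (suc i) zero _ ()
  distinct-g (suc i) (suc j) i≢j = distinct i j (i≢j ∘ cong suc) ∘ Fin.suc-injective
  Pg : ∀ i → P (g i) ≡ true
  Pg zero = P0
  Pg (suc i) = Pf i

same-residue-mod-3 : ∀ p q {r s} → p * 3 + r ≡ q * 3 + s → r < 3 → s < 3 → r ≡ s
same-residue-mod-3 zero zero eq _ _ = eq
same-residue-mod-3 zero (suc q) eq r<3 _ = ⊥-elim (<⇒≱ r<3 (subst (3 ≤_) (sym eq) (s≤s (s≤s (s≤s z≤n)))))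
same-residue-mod-3 (suc p) zero eq _ s<3 = ⊥-elim (<⇒≱ s<3 (subst (3 ≤_) eq (s≤s (s≤s (s≤s z≤n)))))
same-residue-mod-3 (suc p) (suc q) {r} {s} eq =
  same-residue-mod-3 p q (+-cancelˡ-≡ 3 _ _ (trans (sym (+-assoc 3 (p * 3) r)) (trans eq (+-assoc 3 (q * 3) s))))

same-residue : ∀ {E r s} p q → E + r ≡ p * 3 → E + s ≡ q * 3 → r < 3 → s < 3 → r ≡ s
same-residue {E} {r} {s} p q e₁ e₂ r<3 s<3 = sym (same-residue-mod-3 p q (begin
  p * 3 + s     ≡⟨ cong (_+ s) e₁ ⟨
  E + r + s     ≡⟨ +-assoc E r s ⟩
  E + (r + s)   ≡⟨ cong (E +_) (+-comm r s) ⟩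
  E + (s + r)   ≡⟨ +-assoc E s r ⟨
  E + s + r     ≡⟨ cong (_+ r) e₂ ⟩
  q * 3 + r     ∎) s<3 r<3)
  where open ≡-Reasoning

three-residues : ∀ E p q (i r ha hb : Bool) → 𝟙 i + 𝟙 r ≡ 1 → E + 𝟙 i ≡ p * 3 →
  E + (𝟙 ha * 𝟙 hb + 𝟙 ha * 𝟙 hb) + 𝟙 r ≡ q * 3 → i ≡ false × ha ≡ true × hb ≡ true × q ≡ suc p
three-residues E p q true true _ _ () _ _
three-residues E p q false false _ _ () _ _
three-residues E p q true false ha hb _ e₁ e₂ =
  ⊥-elim (odd≢double {𝟙 ha * 𝟙 hb}
    (trans (same-residue p q e₁ (trans (sym (+-assoc E t 0)) e₂) (s≤s (s≤s z≤n)) (double-𝟙<3 ha hb)) (+-identityʳ t)))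
  where
  t : ℕ
  t = 𝟙 ha * 𝟙 hb + 𝟙 ha * 𝟙 hb
  odd≢double : ∀ {u} → 1 ≢ u + u
  odd≢double {suc u} eq = 1+n≢0 (sym (trans (cong (_∸ 1) eq) (+-suc u u)))
  double-𝟙<3 : ∀ ha hb → 𝟙 ha * 𝟙 hb + 𝟙 ha * 𝟙 hb + 0 < 3
  double-𝟙<3 false hb = s≤s z≤n
  double-𝟙<3 true false = s≤s z≤n
  double-𝟙<3 true true = s≤s (s≤s (s≤s z≤n))
three-residues E p q false true false hb _ e₁ e₂
  with same-residue p q e₁ (trans (cong (_+ 1) (sym (+-identityʳ E))) e₂) (s≤s z≤n) (s≤s (s≤s z≤n))
... | ()
three-residues E p q false true true false _ e₁ e₂
  with same-residue p q e₁ (trans (cong (_+ 1) (sym (+-identityʳ E))) e₂) (s≤s z≤n) (s≤s (s≤s z≤n))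
... | ()
three-residues E p q false true true true _ e₁ e₂ = refl , refl , refl , *-cancelʳ-≡ q (suc p) 3 (begin
  q * 3           ≡⟨ e₂ ⟨
  E + 2 + 1       ≡⟨ +-assoc E 2 1 ⟩
  E + 3           ≡⟨ +-comm E 3 ⟩
  3 + E           ≡⟨ cong (3 +_) (trans (sym (+-identityʳ E)) e₁) ⟩
  3 + p * 3       ∎)
  where open ≡-Reasoning

halves-bound : ∀ {m k} → k + k ≤ suc (2 * m) → k ≤ m
halves-bound {m} {k} 2k≤ = ≤-pred (*-cancelˡ-< 2 k (suc m) (begin-strict
  2 * k           ≡⟨ cong (k +_) (+-identityʳ k) ⟩
  k + k           ≤⟨ 2k≤ ⟩
  suc (2 * m)     <⟨ n<1+n _ ⟩
  2 + 2 * m       ≡⟨ *-suc 2 m ⟨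
  2 * suc m       ∎))
  where open ≤-Reasoning

thirds-bound : ∀ {k p r} → r < 3 → k * 3 ≤ p * 3 + r → k ≤ p
thirds-bound {k} {p} {r} r<3 3k≤ = ≤-pred (*-cancelʳ-< 3 k (suc p) (begin-strict
  k * 3           ≤⟨ 3k≤ ⟩
  p * 3 + r       <⟨ +-monoʳ-< (p * 3) r<3 ⟩
  p * 3 + 3       ≡⟨ +-comm (p * 3) 3 ⟩
  suc p * 3       ∎))
  where open ≤-Reasoning

-- Degrees in induced subgraphs

module Degrees {n} (G : Graph n) where

  A : Fin n → Fin n → ℕ
  A x y = 𝟙 (adj G x y)

  A-sym : ∀ x y → A x y ≡ A y x
  A-sym x y = cong 𝟙 (Graph.sym G x y)

  adj-sym : ∀ {x y} → adj G x y ≡ true → adj G y x ≡ true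
  adj-sym {x} {y} xy = trans (Graph.sym G y x) xy

  adj⇒≢ : ∀ {x y} → adj G x y ≡ true → x ≢ y
  adj⇒≢ {x} xy refl = not-¬ xy (Graph.irrefl G x)

  deg⟨_⟩ : (Fin n → Bool) → Fin n → ℕ
  deg⟨ H ⟩ x = card (λ y → H y ∧ adj G x y)

  deg : Fin n → ℕ
  deg = deg⟨ (λ _ → true) ⟩

  deg⟨⟩-cong : ∀ {H H′} → (∀ y → H y ≡ H′ y) → ∀ x → deg⟨ H ⟩ x ≡ deg⟨ H′ ⟩ x
  deg⟨⟩-cong H≗H′ x = sum-cong-≗ (λ y → cong (λ b → 𝟙 (b ∧ adj G x y)) (H≗H′ y))

  degIn-lookup : ∀ S x → degIn G S x ≡ deg⟨ lookup S ⟩ x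
  degIn-lookup S x = trans (∣∣≡card (S ∩ N G x)) (sum-cong-≗ λ y → cong 𝟙 (begin
    lookup (S ∩ N G x) y         ≡⟨ lookup-zipWith _∧_ y S (tabulate (adj G x)) ⟩
    lookup S y ∧ lookup (N G x) y ≡⟨ cong (lookup S y ∧_) (lookup∘tabulate (adj G x) y) ⟩
    lookup S y ∧ adj G x y        ∎))
    where open ≡-Reasoning

  degIn-tabulate : ∀ H x → degIn G (tabulate H) x ≡ deg⟨ H ⟩ x
  degIn-tabulate H x = trans (degIn-lookup (tabulate H) x) (deg⟨⟩-cong (lookup∘tabulate H) x)

  degIn-⊤ : ∀ x → degIn G ⊤ x ≡ deg x
  degIn-⊤ x = trans (degIn-lookup ⊤ x) (deg⟨⟩-cong lookup-⊤ x)

  CubicExcept : (Fin n → Bool) → Fin n → Set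
  CubicExcept H w = ∀ x → H x ≡ true → deg⟨ H ⟩ x + δ x w ≡ 3

  cubic-contact : ∀ {H w} → CubicExcept H w → H w ≡ true → deg⟨ H ⟩ w ≡ 2
  cubic-contact {H} {w} cubic Hw =
    +-cancelʳ-≡ 1 (deg⟨ H ⟩ w) 2 (trans (cong (deg⟨ H ⟩ w +_) (sym (δ-refl w))) (cubic w Hw))

  cubic-other : ∀ {H w x} → CubicExcept H w → H x ≡ true → x ≢ w → deg⟨ H ⟩ x ≡ 3
  cubic-other {H} {w} {x} cubic Hx x≢w =
    trans (sym (+-identityʳ (deg⟨ H ⟩ x))) (trans (cong (deg⟨ H ⟩ x +_) (sym (δ-≢ x≢w))) (cubic x Hx))

  deg⟨⟩≤deg : ∀ H x → deg⟨ H ⟩ x ≤ deg x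
  deg⟨⟩≤deg H x = card-mono (λ y Hxy → proj₂ (∧-true⁻ {H y} Hxy))

  deg⟨⟩-all-neighbours : ∀ {H x} → (∀ y → adj G x y ≡ true → H y ≡ true) → deg⟨ H ⟩ x ≡ deg x
  deg⟨⟩-all-neighbours {H} {x} neighbours⊆H = card-cong same
    where
    same : ∀ y → (H y ∧ adj G x y) ≡ adj G x y
    same y with adj G x y in xy
    ... | true = trans (cong (_∧ true) (neighbours⊆H y xy)) refl
    ... | false = ∧-zeroʳ (H y)

  deg⟨⟩-partition : ∀ {P Q x} → (∀ y → adj G x y ≡ true → 𝟙 (P y) + 𝟙 (Q y) ≡ 1) →
    deg⟨ P ⟩ x + deg⟨ Q ⟩ x ≡ deg x
  deg⟨⟩-partition {P} {Q} {x} split = trans (sym (∑-distrib-+ (λ y → 𝟙 (P y ∧ adj G x y)) (λ y → 𝟙 (Q y ∧ adj G x y))))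
    (sum-cong-≗ each)
    where
    each : ∀ y → 𝟙 (P y ∧ adj G x y) + 𝟙 (Q y ∧ adj G x y) ≡ A x y
    each y with adj G x y in xy
    ... | true rewrite ∧-identityʳ (P y) | ∧-identityʳ (Q y) = split y xy
    ... | false rewrite ∧-zeroʳ (P y) | ∧-zeroʳ (Q y) = refl

  deg-split-off : ∀ {H v x} → H v ≡ false → (∀ y → adj G x y ≡ true → y ≢ v → H y ≡ true) →
    deg x ≡ deg⟨ H ⟩ x + A x v
  deg-split-off {H} {v} {x} Hv neighbours⊆H+v = begin
    deg x                                         ≡⟨ sum-cong-≗ (λ y → split y (y ≟ v)) ⟩
    sum (λ y → 𝟙 (H y ∧ adj G x y) + δ y v * A x y) ≡⟨ ∑-distrib-+ (λ y → 𝟙 (H y ∧ adj G x y)) (λ y → δ y v * A x y) ⟩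
    deg⟨ H ⟩ x + sum (λ y → δ y v * A x y)       ≡⟨ cong (deg⟨ H ⟩ x +_) (sum-δ v (A x)) ⟩
    deg⟨ H ⟩ x + A x v                            ∎
    where
    open ≡-Reasoning
    split : ∀ y → Dec (y ≡ v) → A x y ≡ 𝟙 (H y ∧ adj G x y) + δ y v * A x y
    split y (yes refl) rewrite Hv | δ-refl y = sym (+-identityʳ (A x y))
    split y (no y≢v) rewrite δ-≢ y≢v with adj G x y in xy
    ... | true rewrite neighbours⊆H+v y xy y≢v = refl
    ... | false = sym (trans (+-identityʳ _) (cong 𝟙 (∧-zeroʳ (H y))))

  edges : (Fin n → Bool) → (Fin n → Bool) → ℕ
  edges P Q = sum (λ x → sum (λ y → 𝟙 ((P x ∧ Q y) ∧ adj G x y)))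

  edges-sym : ∀ P Q → edges P Q ≡ edges Q P
  edges-sym P Q = trans (∑-comm (λ x y → 𝟙 ((P x ∧ Q y) ∧ adj G x y)))
    (sum-cong-≗ λ y → sum-cong-≗ λ x → cong 𝟙 (cong₂ _∧_ (∧-comm (P x) (Q y)) (Graph.sym G x y)))

  edges-as-degrees : ∀ P Q → edges P Q ≡ sum (λ x → 𝟙 (P x) * deg⟨ Q ⟩ x)
  edges-as-degrees P Q = sum-cong-≗ λ x → begin
    sum (λ y → 𝟙 ((P x ∧ Q y) ∧ adj G x y))   ≡⟨ sum-cong-≗ (λ y → trans (cong 𝟙 (∧-assoc (P x) (Q y) (adj G x y))) (𝟙-∧ (P x) _)) ⟩
    sum (λ y → 𝟙 (P x) * 𝟙 (Q y ∧ adj G x y)) ≡⟨ sum-*ˡ (𝟙 (P x)) (λ y → 𝟙 (Q y ∧ adj G x y)) ⟩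
    𝟙 (P x) * deg⟨ Q ⟩ x                       ∎
    where open ≡-Reasoning

  edges-split : ∀ P {Q Q₁ Q₂} → (∀ y → 𝟙 (Q y) ≡ 𝟙 (Q₁ y) + 𝟙 (Q₂ y)) →
    edges P Q ≡ edges P Q₁ + edges P Q₂
  edges-split P {Q} {Q₁} {Q₂} Q≡Q₁+Q₂ = begin
    edges P Q                                       ≡⟨ sum-cong-≗ (λ x → sum-cong-≗ (λ y → split (P x) (adj G x y) (Q≡Q₁+Q₂ y))) ⟩
    sum (λ x → sum (λ y → q₁ x y + q₂ x y))         ≡⟨ sum-cong-≗ (λ x → ∑-distrib-+ (q₁ x) (q₂ x)) ⟩
    sum (λ x → sum (q₁ x) + sum (q₂ x))             ≡⟨ ∑-distrib-+ (λ x → sum (q₁ x)) (λ x → sum (q₂ x)) ⟩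
    edges P Q₁ + edges P Q₂                         ∎
    where
    open ≡-Reasoning
    q₁ q₂ : Fin n → Fin n → ℕ
    q₁ x y = 𝟙 ((P x ∧ Q₁ y) ∧ adj G x y)
    q₂ x y = 𝟙 ((P x ∧ Q₂ y) ∧ adj G x y)
    split : ∀ a c {b b₁ b₂} → 𝟙 b ≡ 𝟙 b₁ + 𝟙 b₂ → 𝟙 ((a ∧ b) ∧ c) ≡ 𝟙 ((a ∧ b₁) ∧ c) + 𝟙 ((a ∧ b₂) ∧ c)
    split false c _ = refl
    split true false {b} {b₁} {b₂} _ rewrite ∧-zeroʳ b | ∧-zeroʳ b₁ | ∧-zeroʳ b₂ = refl
    split true true {b} {b₁} {b₂} b≡b₁+b₂ rewrite ∧-identityʳ b | ∧-identityʳ b₁ | ∧-identityʳ b₂ = b≡b₁+b₂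

  edges-independent : ∀ {P} → (∀ x y → P x ≡ true → P y ≡ true → adj G x y ≡ false) → edges P P ≡ 0
  edges-independent {P} independent = sum-zero λ x → sum-zero λ y → none x y
    where
    none : ∀ x y → 𝟙 ((P x ∧ P y) ∧ adj G x y) ≡ 0
    none x y with P x in Px | P y in Py
    ... | false | _ = refl
    ... | true | false = refl
    ... | true | true rewrite independent x y Px Py = refl

  edges-cubic : ∀ {H w P} → CubicExcept H w → P ⊆ᵇ H → edges P H + 𝟙 (P w) ≡ card P * 3
  edges-cubic {H} {w} {P} cubic P⊆H = begin
    edges P H + 𝟙 (P w)
      ≡⟨ cong₂ _+_ (edges-as-degrees P H) (sym (sum-δ w (𝟙 ∘ P))) ⟩
    sum (λ x → 𝟙 (P x) * deg⟨ H ⟩ x) + sum (λ x → δ x w * 𝟙 (P x))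
      ≡⟨ ∑-distrib-+ (λ x → 𝟙 (P x) * deg⟨ H ⟩ x) (λ x → δ x w * 𝟙 (P x)) ⟨
    sum (λ x → 𝟙 (P x) * deg⟨ H ⟩ x + δ x w * 𝟙 (P x))
      ≡⟨ sum-cong-≗ three-each ⟩
    sum (λ x → 3 * 𝟙 (P x))
      ≡⟨ trans (sum-*ˡ 3 (𝟙 ∘ P)) (*-comm 3 (card P)) ⟩
    card P * 3 ∎
    where
    open ≡-Reasoning
    three-each : ∀ x → 𝟙 (P x) * deg⟨ H ⟩ x + δ x w * 𝟙 (P x) ≡ 3 * 𝟙 (P x)
    three-each x with P x in Px
    ... | false = cong (0 +_) (*-zeroʳ (δ x w))
    ... | true = trans (cong₂ _+_ (*-identityˡ (deg⟨ H ⟩ x)) (*-identityʳ (δ x w))) (cubic x (P⊆H x Px))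

  edges-≤ : ∀ {P Q d} → (∀ y → Q y ≡ true → deg y ≤ d) → edges P Q ≤ card Q * d
  edges-≤ {P} {Q} {d} deg≤d = begin
    edges P Q                          ≡⟨ trans (edges-sym P Q) (edges-as-degrees Q P) ⟩
    sum (λ y → 𝟙 (Q y) * deg⟨ P ⟩ y)   ≤⟨ sum-mono-≤ each ⟩
    sum (λ y → 𝟙 (Q y) * d)            ≡⟨ *-distribʳ-sum d (𝟙 ∘ Q) ⟨
    card Q * d                         ∎
    where
    open ≤-Reasoning
    each : ∀ y → 𝟙 (Q y) * deg⟨ P ⟩ y ≤ 𝟙 (Q y) * d
    each y with Q y in Qy
    ... | false = z≤n
    ... | true = *-monoʳ-≤ 1 (≤-trans (deg⟨⟩≤deg P y) (deg≤d y Qy))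

  matching-bound : ∀ {S k} → MatchingOfSize G S k → k + k ≤ n
  matching-bound {k = k} (f , g , _ , _ , _ , distinct-f , distinct-g , f≢g) = begin
    k + k                             ≡⟨ cong₂ _+_ (card-image f distinct-f) (card-image g distinct-g) ⟨
    card (image f) + card (image g)   ≡⟨ card-∪-disjoint {P = image f} {Q = image g} apart ⟨
    card (image f ∪ᵇ image g)         ≤⟨ sum-≤-length _ (λ v → 𝟙≤1 _) ⟩
    n                                 ∎
    where
    open ≤-Reasoning
    apart : ∀ v → image f v ≡ true → image g v ≡ false
    apart v v∈f with image g v Bool.≟ true
    ... | no v∉g = ¬-not v∉g
    ... | yes v∈g with image-elim f v v∈f | image-elim g v v∈g
    ... | i , fi≡v | j , gj≡v = ⊥-elim (f≢g i j (trans fi≡v (sym gj≡v)))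

  module _ {z : Fin n} (cubic : CubicExcept (λ _ → true) z) where

    deg≤3 : ∀ v → deg v ≤ 3
    deg≤3 v = subst (deg v ≤_) (cubic v refl) (m≤m+n (deg v) (δ v z))

    -- All edges at an independent set P leave it, and its complement absorbs at most 3 per vertex.
    independent-set-bound : ∀ {S k} → IndepSetOfSize G S k → k + k ≤ n
    independent-set-bound {k = k} (f , _ , distinct , independent) = begin
      k + k              ≡⟨ cong (_+ k) (card-image f distinct) ⟨
      card P + k         ≤⟨ +-monoʳ-≤ (card P) (thirds-bound (s≤s (s≤s z≤n)) edge-count) ⟩
      card P + card Pᶜ   ≡⟨ card-complement P ⟩
      n                  ∎
      where
      open ≤-Reasoning
      P Pᶜ : Fin n → Bool
      P = image f
      Pᶜ = not ∘ P
      P-independent : ∀ x y → P x ≡ true → P y ≡ true → adj G x y ≡ false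
      P-independent x y Px Py with image-elim f x Px | image-elim f y Py
      ... | i , refl | j , refl = independent i j
      edge-count : k * 3 ≤ card Pᶜ * 3 + 1
      edge-count = begin
        k * 3                            ≡⟨ cong (_* 3) (card-image f distinct) ⟨
        card P * 3                       ≡⟨ edges-cubic cubic (λ _ _ → refl) ⟨
        edges P (λ _ → true) + 𝟙 (P z)   ≡⟨ cong (_+ 𝟙 (P z)) (edges-split P (λ y → sym (𝟙+𝟙-not (P y)))) ⟩
        edges P P + edges P Pᶜ + 𝟙 (P z) ≡⟨ cong (λ e → e + edges P Pᶜ + 𝟙 (P z)) (edges-independent P-independent) ⟩
        edges P Pᶜ + 𝟙 (P z)             ≤⟨ +-mono-≤ (edges-≤ (λ y _ → deg≤3 y)) (𝟙≤1 (P z)) ⟩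
        card Pᶜ * 3 + 1                  ∎

-- Hall's theorem

module Hall {n} (E : Fin n → Fin n → Bool) where

  Γ⟨_⟩ : (Fin n → Bool) → (Fin n → Bool) → Fin n → Bool
  Γ⟨ B ⟩ X y = B y ∧ any (λ x → X x ∧ E x y)

  Γ-intro : ∀ {B X x y} → B y ≡ true → X x ≡ true → E x y ≡ true → Γ⟨ B ⟩ X y ≡ true
  Γ-intro {X = X} {x} {y} By Xx Exy = ∧-true⁺ By (any-complete (λ x → X x ∧ E x y) x (∧-true⁺ Xx Exy))

  Γ-elim : ∀ {B X y} → Γ⟨ B ⟩ X y ≡ true → B y ≡ true × ∃ λ x → X x ≡ true × E x y ≡ true
  Γ-elim {B} {X} {y} Γy with ∧-true⁻ {B y} Γy
  ... | By , any≡true with any-sound (λ x → X x ∧ E x y) any≡true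
  ... | x , XEx = By , x , ∧-true⁻ XEx

  HallCondition : (Fin n → Bool) → (Fin n → Bool) → Set
  HallCondition A B = ∀ X → X ⊆ᵇ A → card X ≤ card (Γ⟨ B ⟩ X)

  record Matching (A B : Fin n → Bool) : Set where
    field
      partner : ∀ a → A a ≡ true → Fin n
      partner-∈ : ∀ a p → B (partner a p) ≡ true
      partner-adj : ∀ a p → E a (partner a p) ≡ true
      partner-injective : ∀ a a′ p p′ → partner a p ≡ partner a′ p′ → a ≡ a′

  empty-matching : ∀ {A B} → (∀ a → A a ≢ true) → Matching A B
  empty-matching A-empty = record
    { partner = λ a p → ⊥-elim (A-empty a p)
    ; partner-∈ = λ a p → ⊥-elim (A-empty a p)
    ; partner-adj = λ a p → ⊥-elim (A-empty a p)
    ; partner-injective = λ a _ p _ _ → ⊥-elim (A-empty a p)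
    }

  edge-matching : ∀ {a b} → E a b ≡ true → Matching (_== a) (_== b)
  edge-matching {a} {b} Eab = record
    { partner = λ _ _ → b
    ; partner-∈ = λ _ _ → ==-refl b
    ; partner-adj = λ x x≡a → ==-subst (λ x → E x b) x≡a Eab
    ; partner-injective = λ _ _ x≡a x′≡a _ → trans (==-sound x≡a) (sym (==-sound x′≡a))
    }

  restrict-targets : ∀ {A B B′} (M : Matching A B) → (∀ a p → B′ (Matching.partner M a p) ≡ true) →
    Matching A B′
  restrict-targets M B′-partner = record { Matching M; partner-∈ = B′-partner }

  join-matchings : ∀ {A A₁ A₂ B B₁ B₂} → (∀ a → A a ≡ true → A₁ a ≡ true ⊎ A₂ a ≡ true) →
    B₁ ⊆ᵇ B → B₂ ⊆ᵇ B → (∀ y → B₁ y ≡ true → B₂ y ≡ false) →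
    Matching A₁ B₁ → Matching A₂ B₂ → Matching A B
  join-matchings {A} {A₁} {A₂} {B} {B₁} {B₂} cover B₁⊆B B₂⊆B disjoint M₁ M₂ = record
    { partner = λ a p → partner-of (cover a p)
    ; partner-∈ = λ a p → partner-of-∈ (cover a p)
    ; partner-adj = λ a p → partner-of-adj (cover a p)
    ; partner-injective = λ a a′ p p′ → partner-of-injective (cover a p) (cover a′ p′)
    }
    where
    module M₁ = Matching M₁
    module M₂ = Matching M₂
    partner-of : ∀ {a} → A₁ a ≡ true ⊎ A₂ a ≡ true → Fin n
    partner-of {a} (inj₁ p) = M₁.partner a p
    partner-of {a} (inj₂ p) = M₂.partner a p
    partner-of-∈ : ∀ {a} (c : A₁ a ≡ true ⊎ A₂ a ≡ true) → B (partner-of c) ≡ true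
    partner-of-∈ {a} (inj₁ p) = B₁⊆B _ (M₁.partner-∈ a p)
    partner-of-∈ {a} (inj₂ p) = B₂⊆B _ (M₂.partner-∈ a p)
    partner-of-adj : ∀ {a} (c : A₁ a ≡ true ⊎ A₂ a ≡ true) → E a (partner-of c) ≡ true
    partner-of-adj {a} (inj₁ p) = M₁.partner-adj a p
    partner-of-adj {a} (inj₂ p) = M₂.partner-adj a p
    apart : ∀ {a a′} p p′ → M₁.partner a p ≢ M₂.partner a′ p′
    apart {a} {a′} p p′ eq =
      not-¬ (M₂.partner-∈ a′ p′) (subst (λ y → B₂ y ≡ false) eq (disjoint _ (M₁.partner-∈ a p)))
    partner-of-injective : ∀ {a a′} (c : A₁ a ≡ true ⊎ A₂ a ≡ true) (c′ : A₁ a′ ≡ true ⊎ A₂ a′ ≡ true) →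
      partner-of c ≡ partner-of c′ → a ≡ a′
    partner-of-injective (inj₁ p) (inj₁ p′) = M₁.partner-injective _ _ p p′
    partner-of-injective (inj₂ p) (inj₂ p′) = M₂.partner-injective _ _ p p′
    partner-of-injective (inj₁ p) (inj₂ p′) eq = ⊥-elim (apart p p′ eq)
    partner-of-injective (inj₂ p) (inj₁ p′) eq = ⊥-elim (apart p′ p (sym eq))

  Tight : (A B X : Fin n → Bool) → Set
  Tight A B X =
    X ⊆ᵇ A × (∃ λ x → X x ≡ true) × (∃ λ a → A a ≡ true × X a ≡ false) × card (Γ⟨ B ⟩ X) ≤ card X

  tight? : ∀ A B X → Dec (Tight A B X)
  tight? A B X =
    Fin.all? (λ x → (X x Bool.≟ true) →-dec (A x Bool.≟ true)) ×-dec
    Fin.any? (λ x → X x Bool.≟ true) ×-dec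
    Fin.any? (λ a → (A a Bool.≟ true) ×-dec (X a Bool.≟ false)) ×-dec
    (card (Γ⟨ B ⟩ X) ≤? card X)

  Tight-cong : ∀ {A B X Y} → (∀ x → X x ≡ Y x) → Tight A B X → Tight A B Y
  Tight-cong {A} {B} X≗Y (X⊆A , (x , Xx) , (a , Aa , Xa) , ΓX≤X) =
    (λ y Yy → X⊆A y (trans (X≗Y y) Yy)) , (x , trans (sym (X≗Y x)) Xx) , (a , Aa , trans (sym (X≗Y a)) Xa) ,
    subst₂ _≤_ (card-cong (λ y → cong (B y ∧_) (any-cong (λ x → cong (_∧ E x y) (X≗Y x))))) (card-cong X≗Y) ΓX≤X

  -- Adjoining the tight set X to Y ⊆ A ∖ X gains |X| vertices but at most |X| neighbours.
  hall-condition-∖-tight : ∀ {A B X} → HallCondition A B → X ⊆ᵇ A → card (Γ⟨ B ⟩ X) ≤ card X →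
    HallCondition (A ∖ᵇ X) (B ∖ᵇ Γ⟨ B ⟩ X)
  hall-condition-∖-tight {A} {B} {X} hall X⊆A ΓX≤X Y Y⊆A∖X = +-cancelʳ-≤ (card X) (card Y) (card (Γ⟨ B′ ⟩ Y)) (begin
    card Y + card X                ≡⟨ card-∪-disjoint Y∩X≡∅ ⟨
    card (Y ∪ᵇ X)                   ≤⟨ hall (Y ∪ᵇ X) Y∪X⊆A ⟩
    card (Γ⟨ B ⟩ (Y ∪ᵇ X))          ≤⟨ card-mono Γ-split ⟩
    card (Γ⟨ B′ ⟩ Y ∪ᵇ Γ⟨ B ⟩ X)     ≤⟨ card-∪-≤ (Γ⟨ B′ ⟩ Y) (Γ⟨ B ⟩ X) ⟩
    card (Γ⟨ B′ ⟩ Y) + card (Γ⟨ B ⟩ X) ≤⟨ +-monoʳ-≤ (card (Γ⟨ B′ ⟩ Y)) ΓX≤X ⟩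
    card (Γ⟨ B′ ⟩ Y) + card X      ∎)
    where
    open ≤-Reasoning
    B′ : Fin n → Bool
    B′ = B ∖ᵇ Γ⟨ B ⟩ X
    Y∩X≡∅ : ∀ y → Y y ≡ true → X y ≡ false
    Y∩X≡∅ y Yy = not-true⁻ (proj₂ (∧-true⁻ {A y} (Y⊆A∖X y Yy)))
    Y∪X⊆A : (Y ∪ᵇ X) ⊆ᵇ A
    Y∪X⊆A y Y∪Xy with ∨-true⁻ {Y y} Y∪Xy
    ... | inj₁ Yy = proj₁ (∧-true⁻ (Y⊆A∖X y Yy))
    ... | inj₂ Xy = X⊆A y Xy
    Γ-split : Γ⟨ B ⟩ (Y ∪ᵇ X) ⊆ᵇ (Γ⟨ B′ ⟩ Y ∪ᵇ Γ⟨ B ⟩ X)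
    Γ-split y Γy with Γ⟨ B ⟩ X y Bool.≟ true | Γ-elim {B} {Y ∪ᵇ X} Γy
    ... | yes ΓXy | _ = ∨-introʳ ΓXy
    ... | no ΓXy≢true | By , x , Y∪Xx , Exy with ∨-true⁻ {Y x} Y∪Xx
    ... | inj₁ Yx = ∨-introˡ (Γ-intro {B′} {Y} (∧-true⁺ By (cong not (¬-not ΓXy≢true))) Yx Exy)
    ... | inj₂ Xx = ⊥-elim (ΓXy≢true (Γ-intro {B} {X} By Xx Exy))

  -- Without tight sets every nonempty Y ⊆ A ∖ {a₀} has a surplus neighbour, so removing b₀ costs nothing.
  hall-condition-∖-edge : ∀ {A B a₀} b₀ → HallCondition A B → A a₀ ≡ true → (∀ X → ¬ Tight A B X) →
    HallCondition (A ∖ᵇ (_== a₀)) (B ∖ᵇ (_== b₀))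
  hall-condition-∖-edge {A} {B} {a₀} b₀ hall Aa₀ no-tight Y Y⊆A∖a₀ with Fin.any? (λ y → Y y Bool.≟ true)
  ... | no Y-empty = ≤-trans (≤-reflexive (card-empty (λ y Yy → Y-empty (y , Yy)))) z≤n
  ... | yes Y-nonempty = ≤-pred (begin
    suc (card Y)                   ≤⟨ ≰⇒> (λ ΓY≤Y → no-tight Y (Y⊆A , Y-nonempty , (a₀ , Aa₀ , Ya₀) , ΓY≤Y)) ⟩
    card (Γ⟨ B ⟩ Y)                ≤⟨ card-mono Γ-split ⟩
    card (Γ⟨ B′ ⟩ Y ∪ᵇ (_== b₀))    ≤⟨ card-∪-≤ (Γ⟨ B′ ⟩ Y) (_== b₀) ⟩
    card (Γ⟨ B′ ⟩ Y) + card (_== b₀) ≡⟨ trans (cong (card (Γ⟨ B′ ⟩ Y) +_) (card-== b₀)) (+-comm _ 1) ⟩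
    suc (card (Γ⟨ B′ ⟩ Y))         ∎)
    where
    open ≤-Reasoning
    B′ : Fin n → Bool
    B′ = B ∖ᵇ (_== b₀)
    Y⊆A : Y ⊆ᵇ A
    Y⊆A y Yy = proj₁ (∧-true⁻ (Y⊆A∖a₀ y Yy))
    Ya₀ : Y a₀ ≡ false
    Ya₀ with Y a₀ in Y≡
    ... | true = ⊥-elim (not-¬ (proj₂ (∧-true⁻ {A a₀} (Y⊆A∖a₀ a₀ Y≡))) (cong not (==-refl a₀)))
    ... | false = refl
    Γ-split : Γ⟨ B ⟩ Y ⊆ᵇ (Γ⟨ B′ ⟩ Y ∪ᵇ (_== b₀))
    Γ-split y Γy with (y == b₀) Bool.≟ true | Γ-elim {B} {Y} Γy
    ... | yes y≡b₀ | _ = ∨-introʳ y≡b₀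
    ... | no y≢b₀ | By , x , Yx , Exy = ∨-introˡ (Γ-intro {B′} {Y} (∧-true⁺ By (cong not (¬-not y≢b₀))) Yx Exy)

  hall-bounded : ∀ k A B → card A ≤ k → HallCondition A B → Matching A B
  match-beside-tight-set : ∀ k A B → card A ≤ suc k → HallCondition A B → ∀ X → Tight A B X → Matching A B
  match-along-edge : ∀ k A B → card A ≤ suc k → HallCondition A B → ∀ a₀ → A a₀ ≡ true →
    (∀ X → ¬ Tight A B X) → Matching A B

  hall-bounded k A B |A|≤k hall with Fin.any? (λ a → A a Bool.≟ true)
  ... | no A-empty = empty-matching (λ a Aa → A-empty (a , Aa))
  ... | yes (a₀ , Aa₀) with k
  ... | zero = ⊥-elim (<⇒≱ (card-pos a₀ Aa₀) |A|≤k)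
  ... | suc k with anySubset? (λ V → tight? A B (lookup V))
  ... | yes (V , tight) = match-beside-tight-set k A B |A|≤k hall (lookup V) tight
  ... | no no-tight = match-along-edge k A B |A|≤k hall a₀ Aa₀
          (λ X tight → no-tight (tabulate X , Tight-cong (λ x → sym (lookup∘tabulate X x)) tight))

  match-beside-tight-set k A B |A|≤1+k hall X (X⊆A , (x₁ , Xx₁) , (a₁ , Aa₁ , Xa₁) , ΓX≤X) =
    join-matchings cover (λ y Γy → proj₁ (∧-true⁻ Γy)) ∖-⊆ (λ y → ∖-removes {P = B} {Q = Γ⟨ B ⟩ X}) M₁ M₂
    where
    M : Matching X B
    M = hall-bounded k X B (≤-pred (≤-trans (card-mono-< X⊆A a₁ Xa₁ Aa₁) |A|≤1+k))
          (λ Y Y⊆X → hall Y (λ y → X⊆A y ∘ Y⊆X y))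
    open Matching M
    M₁ : Matching X (Γ⟨ B ⟩ X)
    M₁ = restrict-targets M (λ a Xa → Γ-intro {B} {X} (partner-∈ a Xa) Xa (partner-adj a Xa))
    M₂ : Matching (A ∖ᵇ X) (B ∖ᵇ Γ⟨ B ⟩ X)
    M₂ = hall-bounded k (A ∖ᵇ X) (B ∖ᵇ Γ⟨ B ⟩ X)
           (≤-pred (≤-trans (card-mono-< (∖-⊆ {P = A}) x₁ (∖-removes {P = A} {Q = X} Xx₁) (X⊆A x₁ Xx₁)) |A|≤1+k))
           (hall-condition-∖-tight hall X⊆A ΓX≤X)
    cover : ∀ a → A a ≡ true → X a ≡ true ⊎ (A ∖ᵇ X) a ≡ true
    cover a Aa with X a Bool.≟ true
    ... | yes Xa = inj₁ Xa
    ... | no Xa≢true = inj₂ (∖-intro {P = A} {Q = X} Aa Xa≢true)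

  match-along-edge k A B |A|≤1+k hall a₀ Aa₀ no-tight
    with card-pos⁻ {P = Γ⟨ B ⟩ (_== a₀)}
           (subst (_≤ card (Γ⟨ B ⟩ (_== a₀))) (card-== a₀) (hall (_== a₀) (λ a a≡a₀ → ==-subst A a≡a₀ Aa₀)))
  ... | b₀ , Γb₀ with Γ-elim {B} {_== a₀} Γb₀
  ... | Bb₀ , x , x≡a₀ , Exb₀ =
    join-matchings cover (λ y y≡b₀ → ==-subst B y≡b₀ Bb₀) ∖-⊆ (λ y → ∖-removes {P = B} {Q = _== b₀})
      (edge-matching (subst (λ x → E x b₀ ≡ true) (==-sound x≡a₀) Exb₀)) M₂
    where
    M₂ : Matching (A ∖ᵇ (_== a₀)) (B ∖ᵇ (_== b₀))
    M₂ = hall-bounded k (A ∖ᵇ (_== a₀)) (B ∖ᵇ (_== b₀))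
           (≤-pred (≤-trans (card-mono-< (∖-⊆ {P = A}) a₀ (∖-removes {P = A} {Q = _== a₀} (==-refl a₀)) Aa₀) |A|≤1+k))
           (hall-condition-∖-edge b₀ hall Aa₀ no-tight)
    cover : ∀ a → A a ≡ true → (a == a₀) ≡ true ⊎ (A ∖ᵇ (_== a₀)) a ≡ true
    cover a Aa with (a == a₀) Bool.≟ true
    ... | yes a≡a₀ = inj₁ a≡a₀
    ... | no a≢a₀ = inj₂ (∖-intro {P = A} {Q = _== a₀} Aa a≢a₀)

  hall : ∀ {A B} → HallCondition A B → Matching A B
  hall {A} {B} = hall-bounded (card A) A B ≤-refl

-- Connected components

∀⊎∃ : ∀ {n} {A B : Fin n → Set} → (∀ i → A i ⊎ B i) → (∀ i → A i) ⊎ ∃ B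
∀⊎∃ {zero} _ = inj₁ λ ()
∀⊎∃ {suc n} choice with choice zero | ∀⊎∃ (choice ∘ suc)
... | inj₂ b | _ = inj₂ (zero , b)
... | inj₁ _ | inj₂ (i , b) = inj₂ (suc i , b)
... | inj₁ a | inj₁ as = inj₁ λ { zero → a ; (suc i) → as i }

module Components {n} (G : Graph n) where

  ClosedIn : (Fin n → Bool) → (Fin n → Bool) → Set
  ClosedIn S X = ∀ x y → X x ≡ true → S y ≡ true → adj G x y ≡ true → X y ≡ true

  Separation : Subset n → Set
  Separation S = Σ (Fin n → Bool) λ C → ClosedIn (lookup S) C × C ⊆ᵇ lookup S ×
    (∃ λ u → C u ≡ true) × (∃ λ w → lookup S w ≡ true × C w ≡ false)

  Leak : (Fin n → Bool) → (Fin n → Bool) → Set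
  Leak S X = ∃ λ x → ∃ λ y → X x ≡ true × S y ≡ true × adj G x y ≡ true × X y ≡ false

  leak? : ∀ S X → Dec (Leak S X)
  leak? S X = Fin.any? λ x → Fin.any? λ y →
    (X x Bool.≟ true) ×-dec (S y Bool.≟ true) ×-dec (adj G x y Bool.≟ true) ×-dec (X y Bool.≟ false)

  closed-if-no-leak : ∀ {S X} → ¬ Leak S X → ClosedIn S X
  closed-if-no-leak {S} {X} no-leak x y Xx Sy xy with X y Bool.≟ true
  ... | yes Xy = Xy
  ... | no Xy≢true = ⊥-elim (no-leak (x , y , Xx , Sy , xy , ¬-not Xy≢true))

  module Grow (V : Subset n) (u : Fin n) where

    S : Fin n → Bool
    S = lookup V

    grow : (Fin n → Bool) → Fin n → Bool
    grow X x = X x ∨ (S x ∧ any (λ y → X y ∧ adj G y x))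

    reach : ℕ → Fin n → Bool
    reach zero = _== u
    reach (suc k) = grow (reach k)

    grow-⊇ : ∀ X → X ⊆ᵇ grow X
    grow-⊇ X x Xx = ∨-introˡ Xx

    grow-closed : ∀ {X} → ClosedIn S X → ClosedIn S (grow X)
    grow-closed {X} closed x y grow-x Sy xy = ∨-introˡ (closed x y (shrink x grow-x) Sy xy)
      where
      shrink : grow X ⊆ᵇ X
      shrink x grow-x with ∨-true⁻ {X x} grow-x
      ... | inj₁ Xx = Xx
      ... | inj₂ Sx∧any with ∧-true⁻ {S x} Sx∧any
      ... | Sx , any≡true with any-sound (λ y → X y ∧ adj G y x) any≡true
      ... | y , Xy∧yx = closed y x (proj₁ (∧-true⁻ Xy∧yx)) Sx (proj₂ (∧-true⁻ {X y} Xy∧yx))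

    reach-sound : S u ≡ true → ∀ k x → reach k x ≡ true → Reach G V u x × S x ≡ true
    reach-sound Su zero x x≡u with ==-sound {x = x} {u} x≡u
    ... | refl = here (lookup-∈ Su) , Su
    reach-sound Su (suc k) x reach-x with ∨-true⁻ {reach k x} reach-x
    ... | inj₁ earlier = reach-sound Su k x earlier
    ... | inj₂ Sx∧any with ∧-true⁻ {S x} Sx∧any
    ... | Sx , any≡true with any-sound (λ y → reach k y ∧ adj G y x) any≡true
    ... | y , ky∧yx with ∧-true⁻ {reach k y} ky∧yx
    ... | ky , yx = step (proj₁ (reach-sound Su k y ky)) (lookup-∈ Sx) yx , Sx

    reach-root : ∀ k → reach k u ≡ true
    reach-root zero = ==-refl u
    reach-root (suc k) = grow-⊇ (reach k) u (reach-root k)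

    reach-grows : ∀ k → ClosedIn S (reach k) ⊎ suc k ≤ card (reach k)
    reach-grows zero = inj₂ (≤-reflexive (sym (card-== u)))
    reach-grows (suc k) with reach-grows k
    ... | inj₁ closed = inj₁ (grow-closed closed)
    ... | inj₂ big with leak? S (reach k)
    ... | no no-leak = inj₁ (grow-closed (closed-if-no-leak no-leak))
    ... | yes (x , y , kx , Sy , xy , ky) = inj₂ (≤-trans (s≤s big) (card-mono-< (grow-⊇ (reach k)) y ky new))
      where
      new : grow (reach k) y ≡ true
      new = ∨-introʳ (∧-true⁺ Sy (any-complete (λ x → reach k x ∧ adj G x y) x (∧-true⁺ kx xy)))

    component : Fin n → Bool
    component = reach n

    component-closed : ClosedIn S component
    component-closed with reach-grows n
    ... | inj₁ closed = closed
    ... | inj₂ too-big = ⊥-elim (<⇒≱ too-big (sum-≤-length (𝟙 ∘ component) (λ x → 𝟙≤1 (component x))))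

  connected-or-separated : ∀ V → Connected G V ⊎ Separation V
  connected-or-separated V with Fin.any? (λ u → Fin.any? (λ w →
    (lookup V u Bool.≟ true) ×-dec (lookup V w Bool.≟ true) ×-dec (Grow.component V u w Bool.≟ false)))
  ... | yes (u , w , Vu , Vw , unreached) =
    inj₂ (component , component-closed , (λ x → proj₂ ∘ reach-sound Vu n x) , (u , reach-root n) , (w , Vw , unreached))
    where open Grow V u
  ... | no no-separation = inj₁ λ u w u∈V w∈V → reached u w (∈-lookup u∈V) (∈-lookup w∈V)
    where
    reached : ∀ u w → lookup V u ≡ true → lookup V w ≡ true → Reach G V u w
    reached u w Vu Vw with Grow.component V u w Bool.≟ true
    ... | yes uw = proj₁ (Grow.reach-sound V u Vu n w uw)
    ... | no ¬uw = ⊥-elim (no-separation (u , w , Vu , Vw , ¬-not ¬uw))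

-- Vertex partitions into an independent set and a set spanning one edge

record IRPartition {n} (G : Graph n) (I R : Fin n → Bool) : Set where
  field
    covers : ∀ v → I v ≡ true ⊎ R v ≡ true
    disjoint : ∀ v → I v ≡ true → R v ≡ false
    I-independent : ∀ u v → I u ≡ true → I v ≡ true → adj G u v ≡ false
    a b : Fin n
    R-a : R a ≡ true
    R-b : R b ≡ true
    adj-ab : adj G a b ≡ true
    R-edge-unique : ∀ c d → R c ≡ true → R d ≡ true → adj G c d ≡ true →
      (c ≡ a × d ≡ b) ⊎ (c ≡ b × d ≡ a)

module IRPartitionCounting {n} {G : Graph n} {I R} (partition : IRPartition G I R) where
  open IRPartition partition
  open Degrees G

  𝟙I+𝟙R : ∀ v → 𝟙 (I v) + 𝟙 (R v) ≡ 1
  𝟙I+𝟙R v with I v in Iv | covers v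
  ... | true | _ rewrite disjoint v Iv = refl
  ... | false | inj₁ ()
  ... | false | inj₂ Rv rewrite Rv = refl

  a≢b : a ≢ b
  a≢b = adj⇒≢ adj-ab

  -- Only the ordered pairs (a, b) and (b, a) are edges inside R.
  R-edge-indicator : ∀ (H : Fin n → Bool) x y → 𝟙 (((H x ∧ R x) ∧ (H y ∧ R y)) ∧ adj G x y) ≡
    δ x a * (δ y b * (𝟙 (H a) * 𝟙 (H b))) + δ x b * (δ y a * (𝟙 (H a) * 𝟙 (H b)))
  R-edge-indicator H x y with (x ≟ a) ×-dec (y ≟ b) | (x ≟ b) ×-dec (y ≟ a)
  ... | yes (refl , refl) | _ rewrite R-a | R-b | adj-ab | δ-refl a | δ-refl b | δ-≢ a≢b = edge-ab (H a) (H b)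
    where
    edge-ab : ∀ p q → 𝟙 (((p ∧ true) ∧ (q ∧ true)) ∧ true) ≡ 1 * (1 * (𝟙 p * 𝟙 q)) + 0
    edge-ab false q = refl
    edge-ab true false = refl
    edge-ab true true = refl
  ... | _ | yes (refl , refl) rewrite R-a | R-b | adj-sym adj-ab | δ-refl a | δ-refl b | δ-≢ a≢b | δ-≢ (a≢b ∘ sym)
    = edge-ba (H a) (H b)
    where
    edge-ba : ∀ p q → 𝟙 (((q ∧ true) ∧ (p ∧ true)) ∧ true) ≡ 1 * (1 * (𝟙 p * 𝟙 q))
    edge-ba false false = refl
    edge-ba false true = refl
    edge-ba true false = refl
    edge-ba true true = refl
  ... | no ¬ab | no ¬ba = trans no-edge (sym (cong₂ _+_ (δ-pair-zero ¬ab) (δ-pair-zero ¬ba)))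
    where
    δ-pair-zero : ∀ {x p y q : Fin n} {c} → ¬ (x ≡ p × y ≡ q) → δ x p * (δ y q * c) ≡ 0
    δ-pair-zero {x} {p} {y} {q} ¬eq with x ≟ p | y ≟ q
    ... | yes x≡p | yes y≡q = ⊥-elim (¬eq (x≡p , y≡q))
    ... | yes _ | no _ = refl
    ... | no _ | _ = refl
    no-edge : 𝟙 (((H x ∧ R x) ∧ (H y ∧ R y)) ∧ adj G x y) ≡ 0
    no-edge with H x ∧ R x in HRx | H y ∧ R y in HRy | adj G x y in xy
    ... | false | _ | _ = refl
    ... | true | false | _ = refl
    ... | true | true | false = refl
    ... | true | true | true with R-edge-unique x y (proj₂ (∧-true⁻ {H x} HRx)) (proj₂ (∧-true⁻ {H y} HRy)) xy
    ... | inj₁ ab = ⊥-elim (¬ab ab)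
    ... | inj₂ ba = ⊥-elim (¬ba ba)

  edges-within-R : ∀ H → edges (H ∩ᵇ R) (H ∩ᵇ R) ≡ 𝟙 (H a) * 𝟙 (H b) + 𝟙 (H a) * 𝟙 (H b)
  edges-within-R H = begin
    edges (H ∩ᵇ R) (H ∩ᵇ R)
      ≡⟨ sum-cong-≗ (λ x → sum-cong-≗ (R-edge-indicator H x)) ⟩
    sum (λ x → sum (λ y → δ x a * (δ y b * t) + δ x b * (δ y a * t)))
      ≡⟨ sum-cong-≗ (λ x → ∑-distrib-+ (λ y → δ x a * (δ y b * t)) (λ y → δ x b * (δ y a * t))) ⟩
    sum (λ x → sum (λ y → δ x a * (δ y b * t)) + sum (λ y → δ x b * (δ y a * t)))
      ≡⟨ ∑-distrib-+ (λ x → sum (λ y → δ x a * (δ y b * t))) (λ x → sum (λ y → δ x b * (δ y a * t))) ⟩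
    sum (λ x → sum (λ y → δ x a * (δ y b * t))) + sum (λ x → sum (λ y → δ x b * (δ y a * t)))
      ≡⟨ cong₂ _+_ (pick a b) (pick b a) ⟩
    t + t ∎
    where
    open ≡-Reasoning
    t : ℕ
    t = 𝟙 (H a) * 𝟙 (H b)
    pick : ∀ p q → sum (λ x → sum (λ y → δ x p * (δ y q * t))) ≡ t
    pick p q = trans (sum-cong-≗ λ x → trans (sum-*ˡ (δ x p) (λ y → δ y q * t)) (cong (δ x p *_) (sum-δ q (λ _ → t))))
                     (sum-δ p (λ _ → t))

  -- Every edge at I goes to R, so the edges of G[H] at I and at R differ only by the two ends of ab.
  cubic-subgraph-counts : ∀ {H w} → H w ≡ true → CubicExcept H w →
    I w ≡ false × H a ≡ true × H b ≡ true × card (H ∩ᵇ R) ≡ suc (card (H ∩ᵇ I))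
  cubic-subgraph-counts {H} {w} Hw cubic =
    three-residues (edges HI HR) (card HI) (card HR) (I w) (R w) (H a) (H b) (𝟙I+𝟙R w) count-I count-R
    where
    open ≡-Reasoning
    HI HR : Fin n → Bool
    HI = H ∩ᵇ I
    HR = H ∩ᵇ R
    H-split : ∀ y → 𝟙 (H y) ≡ 𝟙 (HI y) + 𝟙 (HR y)
    H-split y with H y
    ... | true = sym (𝟙I+𝟙R y)
    ... | false = refl
    at-w : ∀ P → 𝟙 ((H ∩ᵇ P) w) ≡ 𝟙 (P w)
    at-w P = cong (λ h → 𝟙 (h ∧ P w)) Hw
    count-I : edges HI HR + 𝟙 (I w) ≡ card HI * 3
    count-I = begin
      edges HI HR + 𝟙 (I w)                  ≡⟨ cong₂ _+_ (cong (_+ edges HI HR) (edges-independent {HI} HI-independent)) (at-w I) ⟨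
      edges HI HI + edges HI HR + 𝟙 (HI w)    ≡⟨ cong (_+ 𝟙 (HI w)) (edges-split HI H-split) ⟨
      edges HI H + 𝟙 (HI w)                  ≡⟨ edges-cubic cubic (λ x → proj₁ ∘ ∧-true⁻) ⟩
      card HI * 3                            ∎
      where
      HI-independent : ∀ x y → HI x ≡ true → HI y ≡ true → adj G x y ≡ false
      HI-independent x y HIx HIy = I-independent x y (proj₂ (∧-true⁻ {H x} HIx)) (proj₂ (∧-true⁻ {H y} HIy))
    count-R : edges HI HR + (𝟙 (H a) * 𝟙 (H b) + 𝟙 (H a) * 𝟙 (H b)) + 𝟙 (R w) ≡ card HR * 3
    count-R = begin
      edges HI HR + (𝟙 (H a) * 𝟙 (H b) + 𝟙 (H a) * 𝟙 (H b)) + 𝟙 (R w)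
        ≡⟨ cong₂ _+_ (cong₂ _+_ (edges-sym HR HI) (edges-within-R H)) (at-w R) ⟨
      edges HR HI + edges HR HR + 𝟙 (HR w)   ≡⟨ cong (_+ 𝟙 (HR w)) (edges-split HR H-split) ⟨
      edges HR H + 𝟙 (HR w)                  ≡⟨ edges-cubic cubic (λ x → proj₁ ∘ ∧-true⁻) ⟩
      card HR * 3                            ∎

∈-tabulate⁻ : ∀ {n} {f : Fin n → Bool} {x} → x ∈ tabulate f → f x ≡ true
∈-tabulate⁻ {f = f} {x} x∈ = trans (sym (lookup∘tabulate f x)) (∈-lookup x∈)

∈-tabulate-∩ : ∀ {n} {H P : Fin n → Bool} {x} → x ∈ tabulate (H ∩ᵇ P) → H x ≡ true × P x ≡ true
∈-tabulate-∩ {H = H} {x = x} x∈ = ∧-true⁻ {H x} (∈-tabulate⁻ x∈)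

∈-tabulate⁺ : ∀ {n} {f : Fin n → Bool} {x} → f x ≡ true → x ∈ tabulate f
∈-tabulate⁺ {f = f} {x} fx = lookup-∈ (trans (lookup∘tabulate f x) fx)

module _ {n} {G : Graph n} {z : Fin n} {I R : Subset n} where
  open Degrees G

  bubble-partition : IsBubble G ⊤ z I R → IRPartition G (lookup I) (lookup R)
  bubble-partition (covers , _ , _ , disjoint , _ , _ , _ , independent , a , b , Ra , Rb , ab , unique) = record
    { covers = λ v → Data.Sum.map ∈-lookup ∈-lookup (covers v (lookup-∈ (lookup-⊤ v)))
    ; disjoint = λ v Iv → ∉-lookup (disjoint v (lookup-∈ Iv))
    ; I-independent = λ u v Iu Iv → independent u v (lookup-∈ Iu) (lookup-∈ Iv)
    ; a = a
    ; b = b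
    ; R-a = ∈-lookup Ra
    ; R-b = ∈-lookup Rb
    ; adj-ab = ab
    ; R-edge-unique = λ c d Rc Rd → unique c d (lookup-∈ Rc) (lookup-∈ Rd)
    }

  bubble-cubic : IsBubble G ⊤ z I R → CubicExcept (λ _ → true) z
  bubble-cubic (_ , _ , _ , _ , _ , deg-z , deg-v , _) v _ with v ≟ z
  ... | yes refl = cong (_+ 1) (trans (sym (degIn-⊤ v)) deg-z)
  ... | no v≢z = cong (_+ 0) (trans (sym (degIn-⊤ v)) (deg-v v (lookup-∈ (lookup-⊤ v)) v≢z))

module Bubble {n} (G : Graph n) (z : Fin n) (I R : Subset n) (bubble : IsBubble G ⊤ z I R) where
  open Degrees G
  open Hall (adj G)
  open Components G

  partition : IRPartition G (lookup I) (lookup R)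
  partition = bubble-partition {G = G} {z} {I} {R} bubble

  open IRPartition partition
  open IRPartitionCounting partition

  cubic : CubicExcept (λ _ → true) z
  cubic = bubble-cubic {G = G} {z} {I} {R} bubble

  m : ℕ
  m = card (lookup I)

  contact∉I : lookup I z ≡ false
  contact∉I = proj₁ (cubic-subgraph-counts {λ _ → true} {z} refl cubic)

  card-R : card (lookup R) ≡ suc m
  card-R = proj₂ (proj₂ (proj₂ (cubic-subgraph-counts {λ _ → true} {z} refl cubic)))

  order : n ≡ suc (2 * m)
  order = begin
    n                                        ≡⟨ sum-const-1 n ⟨
    sum {n} (λ _ → 1)                        ≡⟨ sum-cong-≗ (λ v → sym (𝟙I+𝟙R v)) ⟩
    sum (λ v → 𝟙 (lookup I v) + 𝟙 (lookup R v)) ≡⟨ ∑-distrib-+ (𝟙 ∘ lookup I) (𝟙 ∘ lookup R) ⟩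
    m + card (lookup R)                      ≡⟨ cong (m +_) card-R ⟩
    m + suc m                                ≡⟨ +-suc m m ⟩
    suc (m + m)                              ≡⟨ cong (λ t → suc (m + t)) (+-identityʳ m) ⟨
    suc (2 * m)                              ∎
    where open ≡-Reasoning

  enumeration-of-I : Σ (Fin m → Fin n) λ f → Distinct f × (∀ i → lookup I (f i) ≡ true)
  enumeration-of-I = enumerate (lookup I)

  I-enum : Fin m → Fin n
  I-enum = proj₁ enumeration-of-I

  I-enum-distinct : Distinct I-enum
  I-enum-distinct = proj₁ (proj₂ enumeration-of-I)

  I-enum∈I : ∀ i → lookup I (I-enum i) ≡ true
  I-enum∈I = proj₂ (proj₂ enumeration-of-I)

  I∌z : ∀ {v} → lookup I v ≡ true → v ≢ z
  I∌z Iv refl = not-¬ Iv contact∉I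

  independent-set : ∀ S → (∀ v → v ≢ z → v ∈ S) → IndepSetOfSize G S m
  independent-set S S⊇V−z =
    I-enum , (λ i → S⊇V−z (I-enum i) (I∌z (I-enum∈I i))) , I-enum-distinct ,
    (λ i j → I-independent (I-enum i) (I-enum j) (I-enum∈I i) (I-enum∈I j))

  independent-set-upper : ∀ S k → IndepSetOfSize G S k → k ≤ m
  independent-set-upper S k ind = halves-bound (subst (k + k ≤_) order (independent-set-bound cubic ind))

  R−z : Fin n → Bool
  R−z = lookup R ∖ᵇ (_== z)

  -- Each vertex of X ⊆ I sends its 3 edges into R, where z absorbs at most 2 and any other vertex at most 3.
  hall-condition : HallCondition (lookup I) R−z
  hall-condition X X⊆I = thirds-bound (s≤s (s≤s (s≤s z≤n))) (begin
    card X * 3                                   ≡⟨ edges-cubic cubic (λ _ _ → refl) ⟨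
    edges X (λ _ → true) + 𝟙 (X z)               ≡⟨ trans (cong (λ b → edges X (λ _ → true) + 𝟙 b) X∌z) (+-identityʳ _) ⟩
    edges X (λ _ → true)                         ≡⟨ trans (edges-sym X (λ _ → true)) (edges-as-degrees (λ _ → true) X) ⟩
    sum (λ y → 1 * deg⟨ X ⟩ y)                   ≤⟨ sum-mono-≤ (λ y → absorbed y (y ≟ z)) ⟩
    sum (λ y → 𝟙 (Γ⟨ R−z ⟩ X y) * 3 + δ y z * 2) ≡⟨ ∑-distrib-+ (λ y → 𝟙 (Γ⟨ R−z ⟩ X y) * 3) (λ y → δ y z * 2) ⟩
    sum (λ y → 𝟙 (Γ⟨ R−z ⟩ X y) * 3) + sum (λ y → δ y z * 2)
      ≡⟨ cong₂ _+_ (sym (*-distribʳ-sum 3 (𝟙 ∘ Γ⟨ R−z ⟩ X))) (sum-δ z (λ _ → 2)) ⟩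
    card (Γ⟨ R−z ⟩ X) * 3 + 2                    ∎)
    where
    open ≤-Reasoning
    X∌z : X z ≡ false
    X∌z with X z in Xz
    ... | true = ⊥-elim (I∌z (X⊆I z Xz) refl)
    ... | false = refl
    R-neighbour : ∀ {x y} → X x ≡ true → adj G y x ≡ true → lookup R y ≡ true
    R-neighbour {x} {y} Xx yx with covers y
    ... | inj₂ Ry = Ry
    ... | inj₁ Iy = ⊥-elim (not-¬ yx (I-independent y x Iy (X⊆I x Xx)))
    absorbed : ∀ y → Dec (y ≡ z) → 1 * deg⟨ X ⟩ y ≤ 𝟙 (Γ⟨ R−z ⟩ X y) * 3 + δ y z * 2
    absorbed y (yes refl) = begin
      1 * deg⟨ X ⟩ y                   ≤⟨ *-monoʳ-≤ 1 (deg⟨⟩≤deg X y) ⟩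
      1 * deg y                        ≡⟨ trans (*-identityˡ (deg y)) (cubic-contact {λ _ → true} cubic refl) ⟩
      2                                ≡⟨ cong (_* 2) (δ-refl y) ⟨
      δ y y * 2                        ≤⟨ m≤n+m (δ y y * 2) _ ⟩
      𝟙 (Γ⟨ R−z ⟩ X y) * 3 + δ y y * 2 ∎
    absorbed y (no y≢z) with Γ⟨ R−z ⟩ X y Bool.≟ true
    ... | yes Γy = begin
      1 * deg⟨ X ⟩ y                   ≤⟨ *-monoʳ-≤ 1 (deg⟨⟩≤deg X y) ⟩
      1 * deg y                        ≡⟨ cong (1 *_) (cubic-other {λ _ → true} cubic refl y≢z) ⟩
      𝟙 true * 3                       ≡⟨ cong (λ b → 𝟙 b * 3) Γy ⟨
      𝟙 (Γ⟨ R−z ⟩ X y) * 3             ≤⟨ m≤m+n _ (δ y z * 2) ⟩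
      𝟙 (Γ⟨ R−z ⟩ X y) * 3 + δ y z * 2 ∎
    ... | no Γy≢true = ≤-trans (≤-reflexive (cong (1 *_) no-X-neighbour)) z≤n
      where
      no-X-neighbour : deg⟨ X ⟩ y ≡ 0
      no-X-neighbour = card-empty λ x Xx∧yx → let (Xx , yx) = ∧-true⁻ {X x} Xx∧yx in
        Γy≢true (Γ-intro {R−z} {X} (∧-true⁺ (R-neighbour Xx yx) (cong not (==-≢ y≢z))) Xx (adj-sym yx))

  I-matching : Matching (lookup I) R−z
  I-matching = hall hall-condition

  open Matching I-matching

  matched : Fin m → Fin n
  matched i = partner (I-enum i) (I-enum∈I i)

  matched∈R−z : ∀ i → R−z (matched i) ≡ true
  matched∈R−z i = partner-∈ (I-enum i) (I-enum∈I i)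

  matched∈R : ∀ i → lookup R (matched i) ≡ true
  matched∈R i = ∖-⊆ {P = lookup R} {Q = _== z} (matched i) (matched∈R−z i)

  matched≢z : ∀ i → matched i ≢ z
  matched≢z i eq = not-¬ (matched∈R−z i) (∖-removes {P = lookup R} {Q = _== z} (trans (cong (_== z) eq) (==-refl z)))

  matching : ∀ S → (∀ v → v ≢ z → v ∈ S) → MatchingOfSize G S m
  matching S S⊇V−z =
    I-enum , matched , (λ i → S⊇V−z (I-enum i) (I∌z (I-enum∈I i))) , (λ i → S⊇V−z (matched i) (matched≢z i)) ,
    (λ i → partner-adj (I-enum i) (I-enum∈I i)) , I-enum-distinct ,
    (λ i j i≢j eq → I-enum-distinct i j i≢j (partner-injective (I-enum i) (I-enum j) (I-enum∈I i) (I-enum∈I j) eq)) ,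
    (λ i j eq → not-¬ (matched∈R j) (trans (cong (lookup R) (sym eq)) (disjoint (I-enum i) (I-enum∈I i))))

  matching-upper : ∀ S k → MatchingOfSize G S k → k ≤ m
  matching-upper S k ms = halves-bound (subst (k + k ≤_) order (matching-bound ms))

  independence-and-matching-numbers : Σ ℕ λ m → n ≡ suc (2 * m) ×
    IsIndepNumber G ⊤ m × IsIndepNumber G (⊤ ─ ⁅ z ⁆) m ×
    IsMatchingNumber G ⊤ m × IsMatchingNumber G (⊤ ─ ⁅ z ⁆) m
  independence-and-matching-numbers = m , order ,
    (independent-set ⊤ (λ v _ → lookup-∈ (lookup-⊤ v)) , independent-set-upper ⊤) ,
    (independent-set (⊤ ─ ⁅ z ⁆) (λ v → ∈-⊤─⁅⁆) , independent-set-upper (⊤ ─ ⁅ z ⁆)) ,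
    (matching ⊤ (λ v _ → lookup-∈ (lookup-⊤ v)) , matching-upper ⊤) ,
    (matching (⊤ ─ ⁅ z ⁆) (λ v → ∈-⊤─⁅⁆) , matching-upper (⊤ ─ ⁅ z ⁆))

  SubBubble : Set
  SubBubble = Σ (Subset n) λ S → Σ (Fin n) λ z′ → Σ (Subset n) λ I′ → Σ (Subset n) λ R′ →
    (Σ (Fin n) λ v → v ∉ S) × IsBubble G S z′ I′ R′ × I′ ⊆ I × R′ ⊆ R

  ProperCubicSubgraph : Set
  ProperCubicSubgraph =
    Σ (Fin n → Bool) λ H → Σ (Fin n) λ w → H w ≡ true × CubicExcept H w × ∃ λ v → H v ≡ false

  sub-bubble : ProperCubicSubgraph → SubBubble
  sub-bubble (H , w , Hw , cubic-H , (v , Hv)) =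
    tabulate H , w , tabulate HI , tabulate HR , (v , λ v∈H → not-¬ (∈-tabulate⁻ v∈H) Hv) ,
    (covers′ , ∈-tabulate⁺ ∘ proj₁ ∘ in-HI , ∈-tabulate⁺ ∘ proj₁ ∘ in-HR ,
     (λ x x∈I x∈R → not-¬ (proj₂ (in-HR x∈R)) (disjoint x (proj₂ (in-HI x∈I)))) ,
     ∈-tabulate⁺ (∧-true⁺ Hw Rw) ,
     trans (degIn-tabulate H w) (cubic-contact cubic-H Hw) ,
     (λ x x∈ x≢w → trans (degIn-tabulate H x) (cubic-other cubic-H (∈-tabulate⁻ x∈) x≢w)) ,
     (λ x y x∈ y∈ → I-independent x y (proj₂ (in-HI x∈)) (proj₂ (in-HI y∈))) ,
     (a , b , ∈-tabulate⁺ (∧-true⁺ Ha R-a) , ∈-tabulate⁺ (∧-true⁺ Hb R-b) , adj-ab ,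
      λ c d c∈ d∈ → R-edge-unique c d (proj₂ (in-HR c∈)) (proj₂ (in-HR d∈)))) ,
    lookup-∈ ∘ proj₂ ∘ in-HI , lookup-∈ ∘ proj₂ ∘ in-HR
    where
    HI HR : Fin n → Bool
    HI = H ∩ᵇ lookup I
    HR = H ∩ᵇ lookup R
    in-HI : ∀ {x} → x ∈ tabulate HI → H x ≡ true × lookup I x ≡ true
    in-HI = ∈-tabulate-∩ {H = H} {P = lookup I}
    in-HR : ∀ {x} → x ∈ tabulate HR → H x ≡ true × lookup R x ≡ true
    in-HR = ∈-tabulate-∩ {H = H} {P = lookup R}
    counts : lookup I w ≡ false × H a ≡ true × H b ≡ true × card HR ≡ suc (card HI)
    counts = cubic-subgraph-counts Hw cubic-H
    Ha : H a ≡ true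
    Ha = proj₁ (proj₂ counts)
    Hb : H b ≡ true
    Hb = proj₁ (proj₂ (proj₂ counts))
    Rw : lookup R w ≡ true
    Rw with covers w
    ... | inj₂ Rw = Rw
    ... | inj₁ Iw = ⊥-elim (not-¬ Iw (proj₁ counts))
    covers′ : ∀ x → x ∈ tabulate H → x ∈ tabulate HI ⊎ x ∈ tabulate HR
    covers′ x x∈ with covers x
    ... | inj₁ Ix = inj₁ (∈-tabulate⁺ (∧-true⁺ (∈-tabulate⁻ x∈) Ix))
    ... | inj₂ Rx = inj₂ (∈-tabulate⁺ (∧-true⁺ (∈-tabulate⁻ x∈) Rx))

  closed-cubic : ∀ {X} → ClosedIn (λ _ → true) X → CubicExcept X z
  closed-cubic {X} closed x Xx = trans (cong (_+ δ x z) (deg⟨⟩-all-neighbours (λ y → closed x y Xx refl))) (cubic x refl)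

  -- A closed set and its complement are both closed; take the one containing z.
  closed-side : ∀ {X u w} → ClosedIn (λ _ → true) X → X u ≡ true → X w ≡ false → ProperCubicSubgraph
  closed-side {X} {u} {w} closed Xu Xw with X z in Xz
  ... | true = X , z , Xz , closed-cubic closed , (w , Xw)
  ... | false = not ∘ X , z , cong not Xz , closed-cubic complement-closed , (u , cong not Xu)
    where
    complement-closed : ClosedIn (λ _ → true) (not ∘ X)
    complement-closed x y ¬Xx _ xy with X y in Xy
    ... | false = refl
    ... | true = ⊥-elim (not-¬ (closed y x Xy refl (adj-sym xy)) (not-true⁻ ¬Xx))

  module CutVertex (v : Fin n) where

    V−v : Fin n → Bool
    V−v y = not (y == v)

    pendant-side : ∀ X → ClosedIn V−v X → X v ≡ false → X z ≡ false → deg⟨ X ⟩ v ≡ 1 → ProperCubicSubgraph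
    pendant-side X closed Xv Xz one-edge = X , p , Xp , cubic-X , (v , Xv)
      where
      neighbour : ∃ λ p → (X p ∧ adj G v p) ≡ true
      neighbour = card-pos⁻ {P = λ y → X y ∧ adj G v y} (≤-reflexive (sym one-edge))
      p : Fin n
      p = proj₁ neighbour
      Xp : X p ≡ true
      Xp = proj₁ (∧-true⁻ (proj₂ neighbour))
      vp : adj G v p ≡ true
      vp = proj₂ (∧-true⁻ {X p} (proj₂ neighbour))
      only-p : ∀ {x} → X x ≡ true → adj G v x ≡ true → x ≡ p
      only-p {x} Xx vx with x ≟ p
      ... | yes x≡p = x≡p
      ... | no x≢p = ⊥-elim (<⇒≱ (s≤s (s≤s z≤n))
        (subst (2 ≤_) one-edge (card-≥2 {P = λ y → X y ∧ adj G v y} (∧-true⁺ Xx vx) (∧-true⁺ Xp vp) x≢p)))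
      edge-to-v : ∀ {x} → X x ≡ true → A x v ≡ δ x p
      edge-to-v {x} Xx with x ≟ p
      ... | yes refl = trans (A-sym x v) (cong 𝟙 vp)
      ... | no x≢p with adj G x v in xv
      ... | true = ⊥-elim (x≢p (only-p Xx (adj-sym xv)))
      ... | false = refl
      cubic-X : CubicExcept X p
      cubic-X x Xx = begin
        deg⟨ X ⟩ x + δ x p ≡⟨ cong (deg⟨ X ⟩ x +_) (edge-to-v Xx) ⟨
        deg⟨ X ⟩ x + A x v ≡⟨ deg-split-off Xv (λ y xy y≢v → closed x y Xx (cong not (==-≢ y≢v)) xy) ⟨
        deg x              ≡⟨ cubic-other cubic refl (λ x≡z → not-¬ Xx (trans (cong X x≡z) Xz)) ⟩
        3                  ∎
        where open ≡-Reasoning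

    side-with-cut-vertex : ∀ Y → ClosedIn V−v Y → Y v ≡ false → Y z ≡ false → v ≢ z → deg⟨ Y ⟩ v ≡ 2 →
      (∃ λ q → Y q ≡ false × q ≢ v) → ProperCubicSubgraph
    side-with-cut-vertex Y closed Yv Yz v≢z two-edges (q , Yq , q≢v) =
      H , v , Hv , cubic-H , (q , trans (cong (Y q ∨_) (==-≢ q≢v)) (cong (_∨ false) Yq))
      where
      H : Fin n → Bool
      H = Y ∪ᵇ (_== v)
      Hv : H v ≡ true
      Hv = ∨-introʳ (==-refl v)
      deg-v : deg⟨ H ⟩ v ≡ deg⟨ Y ⟩ v
      deg-v = card-cong same
        where
        same : ∀ y → (H y ∧ adj G v y) ≡ (Y y ∧ adj G v y)
        same y with y ≟ v
        ... | yes refl rewrite Graph.irrefl G y = trans (∧-zeroʳ _) (sym (∧-zeroʳ (Y y)))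
        ... | no _ = cong (_∧ adj G v y) (∨-identityʳ (Y y))
      cubic-H : CubicExcept H v
      cubic-H x Hx with x ≟ v
      ... | yes refl = cong (_+ 1) (trans deg-v two-edges)
      ... | no x≢v = begin
        deg⟨ H ⟩ x + 0     ≡⟨ cong (_+ 0) (deg⟨⟩-all-neighbours all-in-H) ⟩
        deg x + 0          ≡⟨ +-identityʳ (deg x) ⟩
        deg x              ≡⟨ cubic-other cubic refl (λ x≡z → not-¬ Yx (trans (cong Y x≡z) Yz)) ⟩
        3                  ∎
        where
        open ≡-Reasoning
        Yx : Y x ≡ true
        Yx with ∨-true⁻ {Y x} Hx
        ... | inj₁ Yx = Yx
        ... | inj₂ ()
        all-in-H : ∀ y → adj G x y ≡ true → H y ≡ true
        all-in-H y xy with y ≟ v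
        ... | yes _ = ∨-zeroʳ (Y y)
        ... | no y≢v = ∨-introˡ (closed x y Yx (cong not (==-≢ y≢v)) xy)

    -- X meets v in one edge and Y in at most two; whichever of them avoids z yields the subgraph.
    one-sided : ∀ X Y → ClosedIn V−v X → ClosedIn V−v Y → X v ≡ false → Y v ≡ false →
      (∀ x → X x ≡ true → Y x ≡ false) → deg⟨ X ⟩ v ≡ 1 → 1 ≤ deg⟨ Y ⟩ v → deg⟨ X ⟩ v + deg⟨ Y ⟩ v ≤ 3 →
      (∃ λ q → X q ≡ true) → ProperCubicSubgraph
    one-sided X Y closed-X closed-Y Xv Yv disjoint-XY one-edge Y-edge at-most-3 (q , Xq) with X z in Xz
    ... | false = pendant-side X closed-X Xv Xz one-edge
    ... | true with deg⟨ Y ⟩ v ℕ.≟ 1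
    ... | yes one-edge-Y = pendant-side Y closed-Y Yv (disjoint-XY z Xz) one-edge-Y
    ... | no ¬one-edge-Y = side-with-cut-vertex Y closed-Y Yv (disjoint-XY z Xz) v≢z two-edges (q , disjoint-XY q Xq , q≢v)
      where
      v≢z : v ≢ z
      v≢z refl = not-¬ Xz Xv
      q≢v : q ≢ v
      q≢v refl = not-¬ Xq Xv
      two-edges : deg⟨ Y ⟩ v ≡ 2
      two-edges = squeeze (deg⟨ Y ⟩ v) Y-edge ¬one-edge-Y (subst (λ d → d + deg⟨ Y ⟩ v ≤ 3) one-edge at-most-3)
        where
        squeeze : ∀ d → 1 ≤ d → d ≢ 1 → 1 + d ≤ 3 → d ≡ 2
        squeeze 1 _ d≢1 _ = ⊥-elim (d≢1 refl)
        squeeze 2 _ _ _ = refl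
        squeeze (suc (suc (suc _))) _ _ (s≤s (s≤s (s≤s ())))

    closed-everywhere : ∀ {X} → ClosedIn V−v X → deg⟨ X ⟩ v ≡ 0 → ClosedIn (λ _ → true) X
    closed-everywhere {X} closed no-edge x y Xx _ xy with y ≟ v
    ... | yes refl = ⊥-elim (<⇒≱ (card-pos {P = λ y → X y ∧ adj G v y} x (∧-true⁺ Xx (adj-sym xy))) (≤-reflexive no-edge))
    ... | no y≢v = closed x y Xx (cong not (==-≢ y≢v)) xy

    cut-vertex-split : Separation (⊤ ─ ⁅ v ⁆) → ProperCubicSubgraph
    cut-vertex-split (C , closed , C⊆V−v , (u , Cu) , (w , V−v-w , Cw)) =
      choose (deg⟨ C ⟩ v ℕ.≟ 0) (deg⟨ D ⟩ v ℕ.≟ 0) (deg⟨ C ⟩ v ℕ.≟ 1)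
      where
      V-lookup : ∀ y → lookup (⊤ ─ ⁅ v ⁆) y ≡ V−v y
      V-lookup = lookup-⊤─⁅⁆ v
      closed-C : ClosedIn V−v C
      closed-C x y Cx V−v-y = closed x y Cx (trans (V-lookup y) V−v-y)
      Cv : C v ≡ false
      Cv with C v in Cv
      ... | true = ⊥-elim (not-¬ (trans (sym (V-lookup v)) (C⊆V−v v Cv)) (cong not (==-refl v)))
      ... | false = refl
      D : Fin n → Bool
      D = V−v ∖ᵇ C
      Dv : D v ≡ false
      Dv = cong (λ b → not b ∧ not (C v)) (==-refl v)
      Dw : D w ≡ true
      Dw = ∖-intro {P = V−v} {Q = C} (trans (sym (V-lookup w)) V−v-w) (λ Cw′ → not-¬ Cw′ Cw)
      Du : D u ≡ false
      Du = ∖-removes {P = V−v} {Q = C} Cu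
      closed-D : ClosedIn V−v D
      closed-D x y Dx V−v-y xy with C y in Cy
      ... | false = ∧-true⁺ V−v-y refl
      ... | true = ⊥-elim (not-¬ (closed-C y x Cy (proj₁ (∧-true⁻ Dx)) (adj-sym xy)) (not-true⁻ (proj₂ (∧-true⁻ {V−v x} Dx))))
      at-most-3 : deg⟨ C ⟩ v + deg⟨ D ⟩ v ≤ 3
      at-most-3 = subst (_≤ 3) (sym (deg⟨⟩-partition {C} {D} split)) (deg≤3 cubic v)
        where
        split : ∀ y → adj G v y ≡ true → 𝟙 (C y) + 𝟙 (D y) ≡ 1
        split y vy with C y
        ... | true = cong (λ b → 1 + 𝟙 b) (∧-zeroʳ (V−v y))
        ... | false = trans (cong 𝟙 (∧-identityʳ (V−v y))) (cong (𝟙 ∘ not) (==-≢ (adj⇒≢ vy ∘ sym)))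
      one-edge-D : ∀ c d → c ≢ 0 → c ≢ 1 → d ≢ 0 → c + d ≤ 3 → d ≡ 1
      one-edge-D 0 _ c≢0 _ _ _ = ⊥-elim (c≢0 refl)
      one-edge-D 1 _ _ c≢1 _ _ = ⊥-elim (c≢1 refl)
      one-edge-D (suc (suc _)) 0 _ _ d≢0 _ = ⊥-elim (d≢0 refl)
      one-edge-D (suc (suc _)) 1 _ _ _ _ = refl
      one-edge-D (suc (suc c)) (suc (suc d)) _ _ _ c+d≤3
        with ≤-trans (≤-reflexive (sym (trans (+-suc c (suc d)) (cong suc (+-suc c d))))) (≤-pred (≤-pred c+d≤3))
      ... | s≤s ()
      choose : Dec (deg⟨ C ⟩ v ≡ 0) → Dec (deg⟨ D ⟩ v ≡ 0) → Dec (deg⟨ C ⟩ v ≡ 1) → ProperCubicSubgraph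
      choose (yes no-edge-C) _ _ = closed-side (closed-everywhere closed-C no-edge-C) Cu Cw
      choose (no _) (yes no-edge-D) _ = closed-side (closed-everywhere closed-D no-edge-D) Dw Du
      choose (no _) (no some-edge-D) (yes one-edge-C) =
        one-sided C D closed-C closed-D Cv Dv (λ _ → ∖-removes {P = V−v} {Q = C}) one-edge-C (n≢0⇒n>0 some-edge-D) at-most-3 (u , Cu)
      choose (no some-edge-C) (no some-edge-D) (no ¬one-edge-C) =
        one-sided D C closed-D closed-C Dv Cv (λ x Dx → not-true⁻ (proj₂ (∧-true⁻ {V−v x} Dx)))
          (one-edge-D (deg⟨ C ⟩ v) (deg⟨ D ⟩ v) some-edge-C ¬one-edge-C some-edge-D at-most-3)
          (n≢0⇒n>0 some-edge-C) (subst (_≤ 3) (+-comm (deg⟨ C ⟩ v) (deg⟨ D ⟩ v)) at-most-3) (w , Dw)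

  order≥3 : 3 ≤ n
  order≥3 = begin
    3                                  ≡⟨ cong (_+ 1) (cubic-contact cubic refl) ⟨
    deg z + 1                          ≡⟨ cong (deg z +_) (card-== z) ⟨
    card (adj G z) + card (_== z)      ≡⟨ card-∪-disjoint {P = adj G z} {Q = _== z} (λ y zy → ==-≢ (adj⇒≢ zy ∘ sym)) ⟨
    card (adj G z ∪ᵇ (_== z))          ≤⟨ sum-≤-length _ (λ y → 𝟙≤1 _) ⟩
    n                                  ∎
    where open ≤-Reasoning

  sub-bubble-unless-2-connected : ¬ TwoConnected G → SubBubble
  sub-bubble-unless-2-connected not-2-connected with connected-or-separated ⊤
  ... | inj₂ (C , closed , _ , (u , Cu) , (w , _ , Cw)) =
    sub-bubble (closed-side (λ x y Cx _ → closed x y Cx (lookup-⊤ y)) Cu Cw)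
  ... | inj₁ connected with ∀⊎∃ (λ v → connected-or-separated (⊤ ─ ⁅ v ⁆))
  ... | inj₁ all-connected = ⊥-elim (not-2-connected (order≥3 , connected , all-connected))
  ... | inj₂ (v , separation) = sub-bubble (CutVertex.cut-vertex-split v separation)

lemma1 : ∀ {n : ℕ} (G : Graph n) (z : Fin n) (I R : Subset n) →
    IsBubble G ⊤ z I R →
    (Σ ℕ λ m →
       n ≡ suc (2 * m) ×
       IsIndepNumber G ⊤ m ×
       IsIndepNumber G (⊤ ─ ⁅ z ⁆) m ×
       IsMatchingNumber G ⊤ m ×
       IsMatchingNumber G (⊤ ─ ⁅ z ⁆) m)
    ×
    (¬ TwoConnected G →
       Σ (Subset n) λ S → Σ (Fin n) λ z′ → Σ (Subset n) λ I′ → Σ (Subset n) λ R′ →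
         (Σ (Fin n) λ v → v ∉ S) ×
         IsBubble G S z′ I′ R′ × I′ ⊆ I × R′ ⊆ R)
lemma1 G z I R bubble = independence-and-matching-numbers , sub-bubble-unless-2-connected
  where open Bubble G z I R bubble
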